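{- Let $\ell\geq 2$, $m\geq 3$, $d$ odd with $d\equiv(-1)^\ell\pmod 6$, let $f=2^m-1$, and let $G=\mathbb Z_2^{m-1}\times\mathbb Z_{2^{\ell+1}d}$. There exists a $(G,\{2^f\},3,1)$-difference family.
   Context: Let $(G,+)$ be a finite abelian group. A partial spread of $G$ is a family $\Sigma$ of subgroups of $G$ whose members pairwise intersect trivially; it has type $\{n_1^{f_1},\dots,n_t^{f_t}\}$ if it consists of exactly $f_i$ subgroups of order $n_i$ for each $i$ (and no others). For a triple $T=\{a,b,c\}$ of three distinct elements of $G$, $\Delta T$ is the multiset $\{\pm(a-b),\pm(a-c),\pm(b-c)\}$, and for a set $\mathcal T$ of triples, $\Delta\mathcal T$ is the multiset union of the $\Delta T$. For a partial spread $\Sigma$, a $(G,\Sigma,3,1)$-difference family is a set $\mathcal T$ of triples of $G$ with $\Delta\mathcal T=G\setminus\bigcup_{S\in\Sigma}S$ as multisets (each element outside the union occurs exactly once, elements of the union do not occur). A $(G,\tau,3,1)$-difference family is a $(G,\Sigma,3,1)$-difference family for some partial spread $\Sigma$ of $G$ of type $\tau$. -}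

module Defs where

open import Data.Nat using (ℕ; zero; suc; _+_; _*_; _∸_; _^_; NonZero)
open import Data.Nat.Properties using (m*n≢0; m^n≢0)
open import Data.Nat.DivMod using (_mod_)
open import Data.Nat.Divisibility using (_∣_; _∣0)
open import Data.Fin using (Fin; toℕ)
open import Data.Vec using (Vec; zipWith; map; replicate)
import Data.Vec.Properties as VecP
import Data.Fin.Properties as FinP
open import Data.Product using (Σ; _×_; _,_; ∃; proj₁)
import Data.Product.Properties as ProdP
open import Data.List using (List; []; _∷_; length; filter; concatMap)
open import Data.List.Membership.Propositional using (_∈_)
open import Data.List.Relation.Unary.Any using (Any)
open import Data.List.Relation.Unary.All using (All)
open import Data.List.Relation.Unary.AllPairs using (AllPairs)
open import Data.List.Relation.Unary.Unique.Propositional using (Unique)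
open import Relation.Binary.PropositionalEquality using (_≡_; _≢_; refl)
open import Relation.Binary.Definitions using (DecidableEquality)
open import Relation.Nullary using (¬_)
open import Data.Empty using (⊥-elim)

record AbGroupData : Set₁ where
  field
    Carrier : Set
    _≟_     : DecidableEquality Carrier
    _⊕_     : Carrier → Carrier → Carrier
    0#      : Carrier
    ⊖_      : Carrier → Carrier

  _⊝_ : Carrier → Carrier → Carrier
  x ⊝ y = x ⊕ (⊖ y)

module _ (n : ℕ) .{{_ : NonZero n}} where
  addMod : Fin n → Fin n → Fin n
  addMod a b = (toℕ a + toℕ b) mod n

  negMod : Fin n → Fin n
  negMod a = (n ∸ toℕ a) mod n

  zeroMod : Fin n
  zeroMod = 0 mod n

ZZ : (k n : ℕ) .{{_ : NonZero n}} → AbGroupData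
ZZ k n = record
  { Carrier = Vec (Fin 2) k × Fin n
  ; _≟_     = ProdP.≡-dec (VecP.≡-dec FinP._≟_) FinP._≟_
  ; _⊕_     = λ { (u , a) (v , b) → zipWith (addMod 2) u v , addMod n a b }
  ; 0#      = replicate k (zeroMod 2) , zeroMod n
  ; ⊖_      = λ { (u , a) → map (negMod 2) u , negMod n a }
  }

odd⇒nz : ∀ ℓ d → ¬ (2 ∣ d) → NonZero (2 ^ suc ℓ * d)
odd⇒nz ℓ zero h = ⊥-elim (h (2 ∣0))
odd⇒nz ℓ (suc d) h = m*n≢0 (2 ^ suc ℓ) (suc d) {{m^n≢0 2 (suc ℓ)}}

module _ (G : AbGroupData) where
  open AbGroupData G

  record Subgroup : Set where
    field
      elems   : List Carrier
      unique  : Unique elems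
      has0    : 0# ∈ elems
      closed⊕ : ∀ {x y} → x ∈ elems → y ∈ elems → (x ⊕ y) ∈ elems
      closed⊖ : ∀ {x} → x ∈ elems → (⊖ x) ∈ elems

  open Subgroup public

  order : Subgroup → ℕ
  order S = length (elems S)

  IsPartialSpread : List Subgroup → Set
  IsPartialSpread Σs = AllPairs (λ S T → ∀ x → x ∈ elems S → x ∈ elems T → x ≡ 0#) Σs

  -- type {n^f}: exactly f subgroups, all of order n
  HasType₁ : ℕ → ℕ → List Subgroup → Set
  HasType₁ n f Σs = (length Σs ≡ f) × All (λ S → order S ≡ n) Σs

  Triple : Set
  Triple = Carrier × Carrier × Carrier

  Distinct : Triple → Set
  Distinct (a , b , c) = (a ≢ b) × (a ≢ c) × (b ≢ c)

  Δ : Triple → List Carrier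
  Δ (a , b , c) = (a ⊝ b) ∷ (b ⊝ a) ∷ (a ⊝ c) ∷ (c ⊝ a) ∷ (b ⊝ c) ∷ (c ⊝ b) ∷ []

  ΔT : List Triple → List Carrier
  ΔT = concatMap Δ

  multiplicity : Carrier → List Carrier → ℕ
  multiplicity g xs = length (filter (_≟ g) xs)

  InUnion : List Subgroup → Carrier → Set
  InUnion Σs g = Any (λ S → g ∈ elems S) Σs

  IsDifferenceFamily : List Subgroup → List Triple → Set
  IsDifferenceFamily Σs Ts =
    All Distinct Ts ×
    (∀ g → (InUnion Σs g → multiplicity g (ΔT Ts) ≡ 0)
         × (¬ InUnion Σs g → multiplicity g (ΔT Ts) ≡ 1))

  HasDifferenceFamily₁ : ℕ → ℕ → Set
  HasDifferenceFamily₁ n f =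
    Σ (List Subgroup) λ Σs → IsPartialSpread Σs × HasType₁ n f Σs ×
      Σ (List Triple) λ Ts → IsDifferenceFamily Σs Ts

{-# OPTIONS --safe #-}

-- Write k = m − 1 and N = 2^(ℓ+1) d. The congruence on d makes N = 6t + 2 with t ≡ 1 (mod 4), an
-- order for which Skolem sequences exist, and a Skolem sequence of order t splits {1, …, 3t} into t
-- triples {a, b, a + b}. Let φ be an orthomorphism of ℤ₂ᵏ (φ and v ↦ v + φ v both bijective), e.g.
-- multiplication by a generator of 𝔽₄ or 𝔽₈ on blocks of two or three coordinates. The base triples
-- {0, (v, a), (φ v, a + b)}, v ∈ ℤ₂ᵏ, have the differences (v, ±a), (φ v, ±(a + b)) and
-- (v + φ v, ±b), which hit every element outside ℤ₂ᵏ × {0, N/2} exactly once; that subgroup of order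
-- 2^(k+1) is the union of its 2^(k+1) − 1 subgroups of order two, the partial spread.
module Submission where

open import Defs
open import Data.Nat using (ℕ; suc; _≤_; _∸_; _^_; _*_)
open import Data.Nat.Divisibility using (_∣_)
open import Data.Integer using (ℤ; +_; -1ℤ; _-_)
import Data.Integer.Base as ℤB
import Data.Integer.Divisibility as ℤD
open import Relation.Nullary using (¬_)

open import Data.Nat using (zero; _+_; _<_; z≤n; s≤s; s≤s⁻¹; _≤?_; _<?_; NonZero)
open import Data.Nat.Properties
open import Data.Nat.DivMod using (_%_; _mod_; %-distribˡ-+; m%n%n≡m%n; [m+n]%n≡m%n; m<n⇒m%n≡m; n%n≡0)
open import Data.Nat.Divisibility using (divides)
open import Data.Nat.Tactic.RingSolver using (solve-∀)
import Data.Integer.Properties as ℤP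
open import Data.Parity.Base using (Parity; 0ℙ; 1ℙ)
open import Data.Sign as Sign using (Sign)
open import Data.Fin using (Fin; zero; suc; toℕ; fromℕ<; punchOut; combine; remQuot)
open import Data.Fin.Patterns using (0F; 1F; 2F; 3F; 4F)
import Data.Fin.Properties as Finₚ
open import Data.Vec using (Vec; []; _∷_; zipWith; map; replicate; _++_; take; drop)
open import Data.Vec.Properties
  using ( ∷-injectiveʳ; map-cong; map-id; zipWith-identityˡ; zipWith-identityʳ; zipWith-comm; zipWith-inverseʳ
        ; take++drop≡id; zipWith-++ )
import Data.Vec.Properties as Vecₚ
open import Data.Product using (∃; _×_; _,_; proj₁; proj₂; uncurry)
import Data.Product as Prod
import Data.Product.Properties as Prodₚ
open import Data.Sum using (_⊎_; inj₁; inj₂)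
import Data.Sum as Sum
open import Data.Empty using (⊥-elim)
open import Data.List using (List; []; _∷_; length)
import Data.List as List
import Data.List.Properties as Listₚ
open import Data.List.Membership.Propositional using (_∈_; _∉_)
open import Data.List.Membership.Propositional.Properties using (∈-cartesianProduct⁺; ∈-allFin; ∈-map⁺)
open import Data.List.Relation.Binary.Disjoint.Propositional using (Disjoint)
open import Data.List.Relation.Unary.All using (All; []; _∷_)
import Data.List.Relation.Unary.All as All
import Data.List.Relation.Unary.All.Properties as All
open import Data.List.Relation.Unary.AllPairs using (AllPairs; []; _∷_)
import Data.List.Relation.Unary.AllPairs as AllPairs
import Data.List.Relation.Unary.AllPairs.Properties as AllPairs
open import Data.List.Relation.Unary.Any using (Any; here; there)
import Data.List.Relation.Unary.Any as Any
import Data.List.Relation.Unary.Any.Properties as Any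
open import Data.List.Relation.Unary.Unique.Propositional using (Unique)
import Data.List.Relation.Unary.Unique.Propositional.Properties as Unique
open import Function using (_∘_; id)
open import Relation.Binary.Definitions using (DecidableEquality)
open import Relation.Binary.PropositionalEquality
open import Relation.Nullary using (Dec; yes; no; map′; ¬?)
open import Relation.Nullary.Decidable using (from-yes; from-no)
open import Relation.Unary using (Decidable)

Z₂^_ : ℕ → Set
Z₂^ k = Vec (Fin 2) k

infixl 6 _+₂_

_+₂_ : ∀ {k} → Z₂^ k → Z₂^ k → Z₂^ k
_+₂_ = zipWith (addMod 2)

0₂ : ∀ {k} → Z₂^ k
0₂ = replicate _ (zeroMod 2)

negMod-2 : ∀ a → negMod 2 a ≡ a
negMod-2 0F = refl
negMod-2 1F = refl

addMod-2-comm : ∀ a b → addMod 2 a b ≡ addMod 2 b a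
addMod-2-comm 0F 0F = refl
addMod-2-comm 0F 1F = refl
addMod-2-comm 1F 0F = refl
addMod-2-comm 1F 1F = refl

addMod-2-identityˡ : ∀ a → addMod 2 (zeroMod 2) a ≡ a
addMod-2-identityˡ 0F = refl
addMod-2-identityˡ 1F = refl

addMod-2-identityʳ : ∀ a → addMod 2 a (zeroMod 2) ≡ a
addMod-2-identityʳ 0F = refl
addMod-2-identityʳ 1F = refl

addMod-2-self : ∀ a → addMod 2 a a ≡ zeroMod 2
addMod-2-self 0F = refl
addMod-2-self 1F = refl

module _ {k : ℕ} where

  neg₂≗id : map (negMod 2) ≗ id {A = Z₂^ k}
  neg₂≗id v = trans (map-cong negMod-2 v) (map-id v)

  +₂-identityˡ : ∀ (v : Z₂^ k) → 0₂ +₂ v ≡ v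
  +₂-identityˡ = zipWith-identityˡ addMod-2-identityˡ

  +₂-identityʳ : ∀ (v : Z₂^ k) → v +₂ 0₂ ≡ v
  +₂-identityʳ = zipWith-identityʳ addMod-2-identityʳ

  +₂-comm : ∀ (u v : Z₂^ k) → u +₂ v ≡ v +₂ u
  +₂-comm = zipWith-comm addMod-2-comm

  +₂-self : ∀ (v : Z₂^ k) → v +₂ v ≡ 0₂
  +₂-self v = trans (cong (v +₂_) (sym (map-id v))) (zipWith-inverseʳ addMod-2-self v)

all-Z₂^? : ∀ {k} {P : Z₂^ k → Set} → Decidable P → Dec (∀ v → P v)
all-Z₂^? {zero} P? = map′ (λ { p [] → p }) (λ f → f []) (P? [])
all-Z₂^? {suc k} P? =
  map′ (λ { f (a ∷ v) → f a v }) (λ f a v → f (a ∷ v)) (Finₚ.all? λ a → all-Z₂^? (λ v → P? (a ∷ v)))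

_≟₂_ : ∀ {k} → DecidableEquality (Z₂^ k)
_≟₂_ = Vecₚ.≡-dec Finₚ._≟_

infix 4 _≗?_

_≗?_ : ∀ {k} (f g : Z₂^ k → Z₂^ k) → Dec (f ≗ g)
f ≗? g = all-Z₂^? λ v → f v ≟₂ g v

allZ₂^ : ∀ k → List (Z₂^ k)
allZ₂^ zero    = [] ∷ []
allZ₂^ (suc k) = List.map (0F ∷_) (allZ₂^ k) List.++ List.map (1F ∷_) (allZ₂^ k)

∈-allZ₂^ : ∀ {k} (v : Z₂^ k) → v ∈ allZ₂^ k
∈-allZ₂^ []       = here refl
∈-allZ₂^ (0F ∷ v) = Any.++⁺ˡ (Any.map⁺ (Any.map (cong (0F ∷_)) (∈-allZ₂^ v)))
∈-allZ₂^ (1F ∷ v) = Any.++⁺ʳ _ (Any.map⁺ (Any.map (cong (1F ∷_)) (∈-allZ₂^ v)))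

length-allZ₂^ : ∀ k → length (allZ₂^ k) ≡ 2 ^ k
length-allZ₂^ zero    = refl
length-allZ₂^ (suc k) = begin
  length (List.map (0F ∷_) (allZ₂^ k) List.++ List.map (1F ∷_) (allZ₂^ k))
    ≡⟨ Listₚ.length-++ (List.map (0F ∷_) (allZ₂^ k)) ⟩
  length (List.map (0F ∷_) (allZ₂^ k)) + length (List.map (1F ∷_) (allZ₂^ k))
    ≡⟨ cong₂ _+_ (Listₚ.length-map _ (allZ₂^ k)) (Listₚ.length-map _ (allZ₂^ k)) ⟩
  length (allZ₂^ k) + length (allZ₂^ k)
    ≡⟨ cong₂ _+_ (length-allZ₂^ k) (trans (length-allZ₂^ k) (sym (+-identityʳ (2 ^ k)))) ⟩
  2 ^ suc k
    ∎
  where open ≡-Reasoning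

cons-unique : ∀ {k} {xs ys : List (Z₂^ k)} → Unique xs → Unique ys →
              Unique (List.map (0F ∷_) xs List.++ List.map (1F ∷_) ys)
cons-unique xs-unique ys-unique = Unique.++⁺ (Unique.map⁺ ∷-injectiveʳ xs-unique) (Unique.map⁺ ∷-injectiveʳ ys-unique) disjoint
  where
  disjoint : Disjoint _ _
  disjoint (v∈0xs , v∈1ys) with Any.satisfied (Any.map⁻ v∈0xs) | Any.satisfied (Any.map⁻ v∈1ys)
  ... | _ , refl | _ , ()

allZ₂^-unique : ∀ k → Unique (allZ₂^ k)
allZ₂^-unique zero    = [] ∷ []
allZ₂^-unique (suc k) = cons-unique (allZ₂^-unique k) (allZ₂^-unique k)

nonzeroZ₂^ : ∀ k → List (∃ λ (v : Z₂^ k) → v ≢ 0₂)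
nonzeroZ₂^ zero    = []
nonzeroZ₂^ (suc k) = List.map (λ (v , v≢0) → 0F ∷ v , v≢0 ∘ ∷-injectiveʳ) (nonzeroZ₂^ k)
                     List.++ List.map (λ v → 1F ∷ v , λ ()) (allZ₂^ k)

proj₁-nonzeroZ₂^ : ∀ k → List.map proj₁ (nonzeroZ₂^ (suc k))
                         ≡ List.map (0F ∷_) (List.map proj₁ (nonzeroZ₂^ k)) List.++ List.map (1F ∷_) (allZ₂^ k)
proj₁-nonzeroZ₂^ k = begin
  List.map proj₁ (nonzeroZ₂^ (suc k))
    ≡⟨ Listₚ.map-++ proj₁ (List.map _ (nonzeroZ₂^ k)) _ ⟩
  List.map proj₁ (List.map _ (nonzeroZ₂^ k)) List.++ List.map proj₁ (List.map _ (allZ₂^ k))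
    ≡⟨ cong₂ List._++_ (trans (sym (Listₚ.map-∘ (nonzeroZ₂^ k))) (Listₚ.map-∘ (nonzeroZ₂^ k)))
                        (sym (Listₚ.map-∘ (allZ₂^ k))) ⟩
  List.map (0F ∷_) (List.map proj₁ (nonzeroZ₂^ k)) List.++ List.map (1F ∷_) (allZ₂^ k)
    ∎
  where open ≡-Reasoning

nonzeroZ₂^-unique : ∀ k → Unique (List.map proj₁ (nonzeroZ₂^ k))
nonzeroZ₂^-unique zero    = []
nonzeroZ₂^-unique (suc k) =
  subst Unique (sym (proj₁-nonzeroZ₂^ k)) (cons-unique (nonzeroZ₂^-unique k) (allZ₂^-unique k))

∈-nonzeroZ₂^ : ∀ {k} (v : Z₂^ k) → v ≢ 0₂ → v ∈ List.map proj₁ (nonzeroZ₂^ k)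
∈-nonzeroZ₂^ []       []≢0 = ⊥-elim ([]≢0 refl)
∈-nonzeroZ₂^ {suc k} (0F ∷ v) 0v≢0 = subst (0F ∷ v ∈_) (sym (proj₁-nonzeroZ₂^ k))
  (Any.++⁺ˡ (Any.map⁺ (Any.map (cong (0F ∷_)) (∈-nonzeroZ₂^ v (0v≢0 ∘ cong (0F ∷_))))))
∈-nonzeroZ₂^ {suc k} (1F ∷ v) _    = subst (1F ∷ v ∈_) (sym (proj₁-nonzeroZ₂^ k))
  (Any.++⁺ʳ _ (Any.map⁺ (Any.map (cong (1F ∷_)) (∈-allZ₂^ v))))

length-nonzeroZ₂^ : ∀ k → length (nonzeroZ₂^ k) ≡ 2 ^ k ∸ 1
length-nonzeroZ₂^ zero    = refl
length-nonzeroZ₂^ (suc k) = begin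
  length (nonzeroZ₂^ (suc k))
    ≡⟨ Listₚ.length-++ (List.map _ (nonzeroZ₂^ k)) ⟩
  length (List.map _ (nonzeroZ₂^ k)) + length (List.map _ (allZ₂^ k))
    ≡⟨ cong₂ _+_ (trans (Listₚ.length-map _ (nonzeroZ₂^ k)) (length-nonzeroZ₂^ k))
                 (trans (Listₚ.length-map _ (allZ₂^ k)) (length-allZ₂^ k)) ⟩
  (2 ^ k ∸ 1) + 2 ^ k
    ≡⟨ +-∸-comm (2 ^ k) (m^n>0 2 k) ⟨
  (2 ^ k + 2 ^ k) ∸ 1
    ≡⟨ cong (λ x → 2 ^ k + x ∸ 1) (+-identityʳ (2 ^ k)) ⟨
  2 ^ suc k ∸ 1
    ∎
  where open ≡-Reasoning

-- Orthomorphisms of ℤ₂ᵏ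

record Orthomorphism (k : ℕ) : Set where
  field
    φ φ⁻¹ ψ⁻¹ : Z₂^ k → Z₂^ k
    φ⁻¹∘φ : φ⁻¹ ∘ φ ≗ id
    φ∘φ⁻¹ : φ ∘ φ⁻¹ ≗ id
    ψ⁻¹∘ψ : ∀ v → ψ⁻¹ (v +₂ φ v) ≡ v
    ψ∘ψ⁻¹ : ∀ v → ψ⁻¹ v +₂ φ (ψ⁻¹ v) ≡ v

-- Multiplication by a primitive element of 𝔽₄ = 𝔽₂[ω]/(ω² + ω + 1), in the basis (1, ω).
orthomorphism₂ : Orthomorphism 2
orthomorphism₂ = record
  { φ     = φ
  ; φ⁻¹   = φ⁻¹
  ; ψ⁻¹   = ψ⁻¹
  ; φ⁻¹∘φ = from-yes (φ⁻¹ ∘ φ ≗? id)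
  ; φ∘φ⁻¹ = from-yes (φ ∘ φ⁻¹ ≗? id)
  ; ψ⁻¹∘ψ = from-yes ((λ v → ψ⁻¹ (v +₂ φ v)) ≗? id)
  ; ψ∘ψ⁻¹ = from-yes ((λ v → ψ⁻¹ v +₂ φ (ψ⁻¹ v)) ≗? id)
  }
  where
  φ φ⁻¹ ψ⁻¹ : Z₂^ 2 → Z₂^ 2
  φ (a ∷ b ∷ []) = b ∷ addMod 2 a b ∷ []
  φ⁻¹ (a ∷ b ∷ []) = addMod 2 a b ∷ a ∷ []
  ψ⁻¹ (a ∷ b ∷ []) = b ∷ addMod 2 a b ∷ []

-- Multiplication by x in 𝔽₈ = 𝔽₂[x]/(x³ + x + 1), in the basis (1, x, x²).
orthomorphism₃ : Orthomorphism 3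
orthomorphism₃ = record
  { φ     = φ
  ; φ⁻¹   = φ⁻¹
  ; ψ⁻¹   = ψ⁻¹
  ; φ⁻¹∘φ = from-yes (φ⁻¹ ∘ φ ≗? id)
  ; φ∘φ⁻¹ = from-yes (φ ∘ φ⁻¹ ≗? id)
  ; ψ⁻¹∘ψ = from-yes ((λ v → ψ⁻¹ (v +₂ φ v)) ≗? id)
  ; ψ∘ψ⁻¹ = from-yes ((λ v → ψ⁻¹ v +₂ φ (ψ⁻¹ v)) ≗? id)
  }
  where
  φ φ⁻¹ ψ⁻¹ : Z₂^ 3 → Z₂^ 3
  φ (a ∷ b ∷ c ∷ []) = c ∷ addMod 2 a c ∷ b ∷ []
  φ⁻¹ (a ∷ b ∷ c ∷ []) = addMod 2 a b ∷ c ∷ a ∷ []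
  ψ⁻¹ (a ∷ b ∷ c ∷ []) = addMod 2 b c ∷ addMod 2 a b ∷ addMod 2 (addMod 2 a b) c ∷ []

take-++ : ∀ {A : Set} {m n} (xs : Vec A m) (ys : Vec A n) → take m (xs ++ ys) ≡ xs
take-++ []       ys = refl
take-++ (x ∷ xs) ys = cong (x ∷_) (take-++ xs ys)

drop-++ : ∀ {A : Set} {m n} (xs : Vec A m) (ys : Vec A n) → drop m (xs ++ ys) ≡ ys
drop-++ []       ys = refl
drop-++ (x ∷ xs) ys = drop-++ xs ys

module _ {m n} (O₁ : Orthomorphism m) (O₂ : Orthomorphism n) where
  private
    module O₁ = Orthomorphism O₁
    module O₂ = Orthomorphism O₂

    _⊕ₘ_ : (Z₂^ m → Z₂^ m) → (Z₂^ n → Z₂^ n) → Z₂^ (m + n) → Z₂^ (m + n)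
    (f ⊕ₘ g) v = f (take m v) ++ g (drop m v)

    ⊕ₘ-++ : ∀ f g (x : Z₂^ m) y → (f ⊕ₘ g) (x ++ y) ≡ f x ++ g y
    ⊕ₘ-++ f g x y = cong₂ (λ x′ y′ → f x′ ++ g y′) (take-++ x y) (drop-++ x y)

    ⊕ₘ-inverse : ∀ f f⁻¹ g g⁻¹ → f⁻¹ ∘ f ≗ id → g⁻¹ ∘ g ≗ id → (f⁻¹ ⊕ₘ g⁻¹) ∘ (f ⊕ₘ g) ≗ id
    ⊕ₘ-inverse f f⁻¹ g g⁻¹ f⁻¹∘f g⁻¹∘g v = begin
      (f⁻¹ ⊕ₘ g⁻¹) (f (take m v) ++ g (drop m v)) ≡⟨ ⊕ₘ-++ f⁻¹ g⁻¹ _ _ ⟩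
      f⁻¹ (f (take m v)) ++ g⁻¹ (g (drop m v))   ≡⟨ cong₂ _++_ (f⁻¹∘f _) (g⁻¹∘g _) ⟩
      take m v ++ drop m v                      ≡⟨ take++drop≡id m v ⟩
      v                                         ∎
      where open ≡-Reasoning

    +₂-++ : ∀ (x x′ : Z₂^ m) (y y′ : Z₂^ n) → (x ++ y) +₂ (x′ ++ y′) ≡ (x +₂ x′) ++ (y +₂ y′)
    +₂-++ x x′ y y′ = zipWith-++ (addMod 2) x y x′ y′

  _⊕ₒ_ : Orthomorphism (m + n)
  _⊕ₒ_ = record
    { φ     = O₁.φ ⊕ₘ O₂.φ
    ; φ⁻¹   = O₁.φ⁻¹ ⊕ₘ O₂.φ⁻¹
    ; ψ⁻¹   = O₁.ψ⁻¹ ⊕ₘ O₂.ψ⁻¹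
    ; φ⁻¹∘φ = ⊕ₘ-inverse O₁.φ O₁.φ⁻¹ O₂.φ O₂.φ⁻¹ O₁.φ⁻¹∘φ O₂.φ⁻¹∘φ
    ; φ∘φ⁻¹ = ⊕ₘ-inverse O₁.φ⁻¹ O₁.φ O₂.φ⁻¹ O₂.φ O₁.φ∘φ⁻¹ O₂.φ∘φ⁻¹
    ; ψ⁻¹∘ψ = ψ⁻¹∘ψ
    ; ψ∘ψ⁻¹ = ψ∘ψ⁻¹
    }
    where
    open ≡-Reasoning

    ψ⁻¹∘ψ : ∀ v → (O₁.ψ⁻¹ ⊕ₘ O₂.ψ⁻¹) (v +₂ (O₁.φ ⊕ₘ O₂.φ) v) ≡ v
    ψ⁻¹∘ψ v = begin
      (O₁.ψ⁻¹ ⊕ₘ O₂.ψ⁻¹) (v +₂ (O₁.φ ⊕ₘ O₂.φ) v)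
        ≡⟨ cong (λ w → (O₁.ψ⁻¹ ⊕ₘ O₂.ψ⁻¹) (w +₂ (O₁.φ ⊕ₘ O₂.φ) v)) (sym (take++drop≡id m v)) ⟩
      (O₁.ψ⁻¹ ⊕ₘ O₂.ψ⁻¹) ((x ++ y) +₂ (O₁.φ x ++ O₂.φ y))
        ≡⟨ cong (O₁.ψ⁻¹ ⊕ₘ O₂.ψ⁻¹) (+₂-++ x _ y _) ⟩
      (O₁.ψ⁻¹ ⊕ₘ O₂.ψ⁻¹) ((x +₂ O₁.φ x) ++ (y +₂ O₂.φ y))
        ≡⟨ ⊕ₘ-++ O₁.ψ⁻¹ O₂.ψ⁻¹ _ _ ⟩
      O₁.ψ⁻¹ (x +₂ O₁.φ x) ++ O₂.ψ⁻¹ (y +₂ O₂.φ y)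
        ≡⟨ cong₂ _++_ (O₁.ψ⁻¹∘ψ x) (O₂.ψ⁻¹∘ψ y) ⟩
      x ++ y
        ≡⟨ take++drop≡id m v ⟩
      v ∎
      where
      x = take m v
      y = drop m v

    ψ∘ψ⁻¹ : ∀ v → (O₁.ψ⁻¹ ⊕ₘ O₂.ψ⁻¹) v +₂ (O₁.φ ⊕ₘ O₂.φ) ((O₁.ψ⁻¹ ⊕ₘ O₂.ψ⁻¹) v) ≡ v
    ψ∘ψ⁻¹ v = begin
      (x′ ++ y′) +₂ (O₁.φ ⊕ₘ O₂.φ) (x′ ++ y′) ≡⟨ cong ((x′ ++ y′) +₂_) (⊕ₘ-++ O₁.φ O₂.φ x′ y′) ⟩
      (x′ ++ y′) +₂ (O₁.φ x′ ++ O₂.φ y′)     ≡⟨ +₂-++ x′ _ y′ _ ⟩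
      (x′ +₂ O₁.φ x′) ++ (y′ +₂ O₂.φ y′)     ≡⟨ cong₂ _++_ (O₁.ψ∘ψ⁻¹ _) (O₂.ψ∘ψ⁻¹ _) ⟩
      take m v ++ drop m v                  ≡⟨ take++drop≡id m v ⟩
      v                                     ∎
      where
      x′ = O₁.ψ⁻¹ (take m v)
      y′ = O₂.ψ⁻¹ (drop m v)

orthomorphism : ∀ k → Orthomorphism (2 + k)
orthomorphism zero          = orthomorphism₂
orthomorphism (suc zero)    = orthomorphism₃
orthomorphism (suc (suc k)) = orthomorphism₂ ⊕ₒ orthomorphism k

-- The modulus is taken of the form suc n, so that zeroMod N and 0# compute to zero.
module Residues (n : ℕ) where
  private
    N = suc n

  infixl 6 _⊝ₙ_
  _⊝ₙ_ : Fin N → Fin N → Fin N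
  a ⊝ₙ b = addMod N a (negMod N b)

  toℕ-addMod : ∀ a b → toℕ (addMod N a b) ≡ (toℕ a + toℕ b) % N
  toℕ-addMod a b = Finₚ.toℕ-fromℕ< _

  toℕ-⊝ₙ : ∀ a b → toℕ (a ⊝ₙ b) ≡ (toℕ a + (N ∸ toℕ b)) % N
  toℕ-⊝ₙ a b = begin
    toℕ (a ⊝ₙ b)                            ≡⟨ toℕ-addMod a (negMod N b) ⟩
    (toℕ a + toℕ (negMod N b)) % N          ≡⟨ cong (λ r → (toℕ a + r) % N) (Finₚ.toℕ-fromℕ< _) ⟩
    (toℕ a + (N ∸ toℕ b) % N) % N          ≡⟨ %-distribˡ-+ (toℕ a) ((N ∸ toℕ b) % N) N ⟩
    (toℕ a % N + (N ∸ toℕ b) % N % N) % N  ≡⟨ cong (λ r → (toℕ a % N + r) % N) (m%n%n≡m%n (N ∸ toℕ b) N) ⟩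
    (toℕ a % N + (N ∸ toℕ b) % N) % N      ≡⟨ %-distribˡ-+ (toℕ a) (N ∸ toℕ b) N ⟨
    (toℕ a + (N ∸ toℕ b)) % N              ∎
    where open ≡-Reasoning

  toℕ-⊝ₙ-≥ : ∀ {a b} → toℕ b ≤ toℕ a → toℕ (a ⊝ₙ b) ≡ toℕ a ∸ toℕ b
  toℕ-⊝ₙ-≥ {a} {b} b≤a = begin
    toℕ (a ⊝ₙ b)                ≡⟨ toℕ-⊝ₙ a b ⟩
    (toℕ a + (N ∸ toℕ b)) % N   ≡⟨ cong (_% N) (+-∸-assoc (toℕ a) (<⇒≤ (Finₚ.toℕ<n b))) ⟨
    (toℕ a + N ∸ toℕ b) % N     ≡⟨ cong (_% N) (+-∸-comm N b≤a) ⟩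
    (toℕ a ∸ toℕ b + N) % N     ≡⟨ [m+n]%n≡m%n (toℕ a ∸ toℕ b) N ⟩
    (toℕ a ∸ toℕ b) % N         ≡⟨ m<n⇒m%n≡m (≤-<-trans (m∸n≤m (toℕ a) (toℕ b)) (Finₚ.toℕ<n a)) ⟩
    toℕ a ∸ toℕ b               ∎
    where open ≡-Reasoning

  toℕ-⊝ₙ-< : ∀ {a b} → toℕ a < toℕ b → toℕ (a ⊝ₙ b) ≡ toℕ a + (N ∸ toℕ b)
  toℕ-⊝ₙ-< {a} {b} a<b = trans (toℕ-⊝ₙ a b) (m<n⇒m%n≡m (begin-strict
    toℕ a + (N ∸ toℕ b)  <⟨ +-monoˡ-< (N ∸ toℕ b) a<b ⟩
    toℕ b + (N ∸ toℕ b)  ≡⟨ m+[n∸m]≡n (<⇒≤ (Finₚ.toℕ<n b)) ⟩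
    N                    ∎))
    where open ≤-Reasoning

  addMod-identityˡ : ∀ a → addMod N zero a ≡ a
  addMod-identityˡ a = Finₚ.toℕ-injective (trans (toℕ-addMod zero a) (m<n⇒m%n≡m (Finₚ.toℕ<n a)))

  addMod-identityʳ : ∀ a → addMod N a zero ≡ a
  addMod-identityʳ a =
    Finₚ.toℕ-injective (trans (toℕ-addMod a zero) (trans (cong (_% N) (+-identityʳ (toℕ a))) (m<n⇒m%n≡m (Finₚ.toℕ<n a))))

  negMod-zero : negMod N zero ≡ zero
  negMod-zero = Finₚ.toℕ-injective (trans (Finₚ.toℕ-fromℕ< _) (n%n≡0 N))

  module _ (a : Fin N) (a+a≡N : toℕ a + toℕ a ≡ N) where

    addMod-self : addMod N a a ≡ zero
    addMod-self = Finₚ.toℕ-injective (begin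
      toℕ (addMod N a a)   ≡⟨ toℕ-addMod a a ⟩
      (toℕ a + toℕ a) % N  ≡⟨ cong (_% N) a+a≡N ⟩
      N % N                ≡⟨ n%n≡0 N ⟩
      0                    ∎)
      where open ≡-Reasoning

    negMod-self : negMod N a ≡ a
    negMod-self = Finₚ.toℕ-injective (begin
      toℕ (negMod N a)             ≡⟨ Finₚ.toℕ-fromℕ< _ ⟩
      (N ∸ toℕ a) % N              ≡⟨ cong (λ x → (x ∸ toℕ a) % N) a+a≡N ⟨
      (toℕ a + toℕ a ∸ toℕ a) % N  ≡⟨ cong (_% N) (m+n∸n≡m (toℕ a) (toℕ a)) ⟩
      toℕ a % N                    ≡⟨ m<n⇒m%n≡m (Finₚ.toℕ<n a) ⟩
      toℕ a                        ∎)
      where open ≡-Reasoning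

module _ {k n : ℕ} where
  open AbGroupData (ZZ k (suc n)) using (_⊕_; ⊖_; 0#)
  open Residues n

  ZZ-identityˡ : ∀ x → 0# ⊕ x ≡ x
  ZZ-identityˡ (u , z) = cong₂ _,_ (+₂-identityˡ u) (addMod-identityˡ z)

  ZZ-identityʳ : ∀ x → x ⊕ 0# ≡ x
  ZZ-identityʳ (u , z) = cong₂ _,_ (+₂-identityʳ u) (addMod-identityʳ z)

  ZZ-⊖0# : ⊖ 0# ≡ 0#
  ZZ-⊖0# = cong₂ _,_ (neg₂≗id 0₂) negMod-zero

-- Subgroups of order two

module OrderTwoSubgroups (G : AbGroupData) where
  open AbGroupData G

  record Involution : Set where
    field
      elem      : Carrier
      elem≢0#   : elem ≢ 0#
      elem⊕elem : elem ⊕ elem ≡ 0#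
      ⊖elem     : ⊖ elem ≡ elem

  open Involution public

  module Spread (⊕-identityˡ : ∀ x → 0# ⊕ x ≡ x) (⊕-identityʳ : ∀ x → x ⊕ 0# ≡ x) (⊖-0# : ⊖ 0# ≡ 0#) where

    module _ (h : Involution) where

      private
        pair : List Carrier
        pair = 0# ∷ elem h ∷ []

      ∈-pair⁻ : ∀ {x} → x ∈ pair → x ≡ 0# ⊎ x ≡ elem h
      ∈-pair⁻ (here x≡0#)        = inj₁ x≡0#
      ∈-pair⁻ (there (here x≡h)) = inj₂ x≡h

      ∈-pair⁺ : ∀ {x} → x ≡ 0# ⊎ x ≡ elem h → x ∈ pair
      ∈-pair⁺ (inj₁ x≡0#) = here x≡0#
      ∈-pair⁺ (inj₂ x≡h)  = there (here x≡h)

      subgroup : Subgroup G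
      subgroup = record
        { elems   = pair
        ; unique  = ((elem≢0# h ∘ sym) ∷ []) ∷ [] ∷ []
        ; has0    = here refl
        ; closed⊕ = λ x∈ y∈ → ∈-pair⁺ (pair-closed⊕ (∈-pair⁻ x∈) (∈-pair⁻ y∈))
        ; closed⊖ = λ x∈ → ∈-pair⁺ (pair-closed⊖ (∈-pair⁻ x∈))
        }
        where
        pair-closed⊕ : ∀ {x y} → x ≡ 0# ⊎ x ≡ elem h → y ≡ 0# ⊎ y ≡ elem h → x ⊕ y ≡ 0# ⊎ x ⊕ y ≡ elem h
        pair-closed⊕ (inj₁ refl) (inj₁ refl) = inj₁ (⊕-identityˡ 0#)
        pair-closed⊕ (inj₁ refl) (inj₂ refl) = inj₂ (⊕-identityˡ (elem h))
        pair-closed⊕ (inj₂ refl) (inj₁ refl) = inj₂ (⊕-identityʳ (elem h))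
        pair-closed⊕ (inj₂ refl) (inj₂ refl) = inj₁ (elem⊕elem h)

        pair-closed⊖ : ∀ {x} → x ≡ 0# ⊎ x ≡ elem h → ⊖ x ≡ 0# ⊎ ⊖ x ≡ elem h
        pair-closed⊖ (inj₁ refl) = inj₁ ⊖-0#
        pair-closed⊖ (inj₂ refl) = inj₂ (⊖elem h)

    spread : List Involution → List (Subgroup G)
    spread = List.map subgroup

    spread-isPartialSpread : ∀ {hs} → Unique (List.map elem hs) → IsPartialSpread G (spread hs)
    spread-isPartialSpread = AllPairs.map⁺ ∘ AllPairs.map (λ {g} {h} → meet {g} {h}) ∘ AllPairs.map⁻
      where
      meet : ∀ {g h} → elem g ≢ elem h → ∀ x → x ∈ elems (subgroup g) → x ∈ elems (subgroup h) → x ≡ 0#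
      meet {g} {h} g≢h x x∈g x∈h with ∈-pair⁻ g x∈g | ∈-pair⁻ h x∈h
      ... | inj₁ x≡0# | _         = x≡0#
      ... | inj₂ _    | inj₁ x≡0# = x≡0#
      ... | inj₂ x≡g  | inj₂ x≡h  = ⊥-elim (g≢h (trans (sym x≡g) x≡h))

    spread-hasType : ∀ hs → HasType₁ G 2 (length hs) (spread hs)
    spread-hasType hs = Listₚ.length-map subgroup hs , All.map⁺ (All.universal (λ _ → refl) hs)

    InUnion-spread⁻ : ∀ {hs x} → InUnion G (spread hs) x → Any (λ h → x ≡ 0# ⊎ x ≡ elem h) hs
    InUnion-spread⁻ = Any.map (λ {h} → ∈-pair⁻ h) ∘ Any.map⁻

    InUnion-spread⁺ : ∀ {hs x} → Any (λ h → x ≡ 0# ⊎ x ≡ elem h) hs → InUnion G (spread hs) x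
    InUnion-spread⁺ = Any.map⁺ ∘ Any.map (λ {h} → ∈-pair⁺ h)

-- Skolem sequences and Heffter systems

-- If y were missed, punching it out would make f an injection Fin (1 + n) → Fin n.
injective⇒surjective : ∀ {n} {f : Fin n → Fin n} → (∀ {x y} → f x ≡ f y → x ≡ y) → ∀ y → ∃ λ x → f x ≡ y
injective⇒surjective {suc n} {f} f-injective y with Finₚ.any? (λ x → f x Finₚ.≟ y)
... | yes fx≡y = fx≡y
... | no  f≢y  = ⊥-elim (Finₚ.<-irrefl i≡j i<j)
  where
  g : Fin (suc n) → Fin n
  g x = punchOut {i = y} {j = f x} (f≢y ∘ (x ,_) ∘ sym)
  collision = Finₚ.pigeonhole (n<1+n n) g
  i = proj₁ collision
  j = proj₁ (proj₂ collision)
  i<j = proj₁ (proj₂ (proj₂ collision))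
  i≡j : i ≡ j
  i≡j = f-injective (Finₚ.punchOut-injective {i = y} _ _ (proj₂ (proj₂ (proj₂ collision))))

-- The symbol i : Fin t stands for the number 1 + i, placed at the positions first i and first i + (1 + i).
occurrence : ∀ {t} → (Fin t → ℕ) → Fin t × Fin 2 → ℕ
occurrence first (i , 0F) = first i
occurrence first (i , 1F) = first i + suc (toℕ i)

record SkolemSequence (t : ℕ) : Set where
  field
    first    : Fin t → ℕ
    occupant : ℕ → Fin t × Fin 2
    occurrence-occupant : ∀ e → 1 ≤ e → e ≤ t * 2 → occurrence first (occupant e) ≡ e

  -- Only the positions need to be checked: occupant is injective on the 2t of them, hence onto.
  occupant-surjective : ∀ x → ∃ λ e → 1 ≤ e × e ≤ t * 2 × occupant e ≡ x
  occupant-surjective x = suc (toℕ e) , s≤s z≤n , Finₚ.toℕ<n e , uncurry-combine-injective fe≡x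
    where
    uncurry-combine-injective : ∀ {x y : Fin t × Fin 2} → uncurry combine x ≡ uncurry combine y → x ≡ y
    uncurry-combine-injective {i , b} {j , c} eq =
      trans (sym (Finₚ.remQuot-combine i b)) (trans (cong (remQuot 2) eq) (Finₚ.remQuot-combine j c))

    f : Fin (t * 2) → Fin (t * 2)
    f e = uncurry combine (occupant (suc (toℕ e)))

    f-injective : ∀ {e e′} → f e ≡ f e′ → e ≡ e′
    f-injective {e} {e′} fe≡fe′ = Finₚ.toℕ-injective (suc-injective (begin
      suc (toℕ e)                                ≡⟨ occurrence-occupant _ (s≤s z≤n) (Finₚ.toℕ<n e) ⟨
      occurrence first (occupant (suc (toℕ e)))  ≡⟨ cong (occurrence first) (uncurry-combine-injective fe≡fe′) ⟩
      occurrence first (occupant (suc (toℕ e′))) ≡⟨ occurrence-occupant _ (s≤s z≤n) (Finₚ.toℕ<n e′) ⟩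
      suc (toℕ e′)                               ∎))
      where open ≡-Reasoning

    e = proj₁ (injective⇒surjective f-injective (uncurry combine x))
    fe≡x = proj₂ (injective⇒surjective f-injective (uncurry combine x))

  occupant-occurrence : ∀ x → occupant (occurrence first x) ≡ x
  occupant-occurrence x with occupant-surjective x
  ... | e , 1≤e , e≤2t , refl = cong occupant (occurrence-occupant e 1≤e e≤2t)

  occurrence-range : ∀ x → 1 ≤ occurrence first x × occurrence first x ≤ t * 2
  occurrence-range x with occupant-surjective x
  ... | e , 1≤e , e≤2t , refl =
    subst (λ o → 1 ≤ o × o ≤ t * 2) (sym (occurrence-occupant e 1≤e e≤2t)) (1≤e , e≤2t)

record HeffterSystem (t : ℕ) : Set where
  field
    entry : Fin t × Fin 3 → ℕ
    index : ℕ → Fin t × Fin 3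
    entry-sum      : ∀ i → entry (i , 0F) + entry (i , 1F) ≡ entry (i , 2F)
    entry-positive : ∀ x → 1 ≤ entry x
    entry-bounded  : ∀ x → entry x ≤ 3 * t
    index-entry    : ∀ x → index (entry x) ≡ x
    entry-index    : ∀ c → 1 ≤ c → c ≤ 3 * t → entry (index c) ≡ c

-- The pair (a, a + δ) of a Skolem sequence, shifted by t, gives the triple (δ, a + t, a + δ + t).
-- The order is a successor only so that index has somewhere to send the junk input 0.
module _ {t₀} (S : SkolemSequence (suc t₀)) where
  open SkolemSequence S
  private
    t = suc t₀

  heffterSystem : HeffterSystem t
  heffterSystem = record
    { entry          = entry
    ; index          = index
    ; entry-sum      = entry-sum
    ; entry-positive = entry-positive
    ; entry-bounded  = entry-bounded
    ; index-entry    = index-entry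
    ; entry-index    = entry-index
    }
    where
    entry : Fin t × Fin 3 → ℕ
    entry (i , 0F)    = suc (toℕ i)
    entry (i , suc b) = occurrence first (i , b) + t

    index : ℕ → Fin t × Fin 3
    index c with c ≤? t
    ... | yes c≤t = fromℕ< (s≤s (∸-monoˡ-≤ 1 c≤t)) , 0F
    ... | no  _   = Prod.map₂ suc (occupant (c ∸ t))

    entry-sum : ∀ i → entry (i , 0F) + entry (i , 1F) ≡ entry (i , 2F)
    entry-sum i = lemma (toℕ i) (first i) t
      where
      lemma : ∀ a f t → suc a + (f + t) ≡ f + suc a + t
      lemma = solve-∀

    3t≡t+t*2 : 3 * t ≡ t + t * 2
    3t≡t+t*2 = lemma t
      where
      lemma : ∀ t → 3 * t ≡ t + t * 2
      lemma = solve-∀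

    entry-positive : ∀ x → 1 ≤ entry x
    entry-positive (i , 0F)    = s≤s z≤n
    entry-positive (i , suc b) = ≤-trans (proj₁ (occurrence-range (i , b))) (m≤m+n _ t)

    entry-bounded : ∀ x → entry x ≤ 3 * t
    entry-bounded (i , 0F)    = ≤-trans (Finₚ.toℕ<n i) (≤-trans (m≤m+n t (t * 2)) (≤-reflexive (sym 3t≡t+t*2)))
    entry-bounded (i , suc b) = begin
      occurrence first (i , b) + t  ≤⟨ +-monoˡ-≤ t (proj₂ (occurrence-range (i , b))) ⟩
      t * 2 + t                     ≡⟨ +-comm (t * 2) t ⟩
      t + t * 2                     ≡⟨ 3t≡t+t*2 ⟨
      3 * t                         ∎
      where open ≤-Reasoning

    index-entry : ∀ x → index (entry x) ≡ x
    index-entry (i , 0F) with suc (toℕ i) ≤? t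
    ... | yes _   = cong (_, 0F) (Finₚ.fromℕ<-toℕ i _)
    ... | no  i≮t = ⊥-elim (i≮t (Finₚ.toℕ<n i))
    index-entry (i , suc b) with occurrence first (i , b) + t ≤? t
    ... | yes o+t≤t = ⊥-elim (<-irrefl refl (≤-trans (+-monoˡ-≤ t (proj₁ (occurrence-range (i , b)))) o+t≤t))
    ... | no  _     = cong (Prod.map₂ suc) (trans (cong occupant (m+n∸n≡m _ t)) (occupant-occurrence (i , b)))

    entry-index : ∀ c → 1 ≤ c → c ≤ 3 * t → entry (index c) ≡ c
    entry-index c 1≤c c≤3t with c ≤? t
    ... | yes _   = trans (cong suc (Finₚ.toℕ-fromℕ< _)) (trans (+-comm 1 (c ∸ 1)) (m∸n+n≡m 1≤c))
    ... | no  c≰t = begin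
      occurrence first (occupant (c ∸ t)) + t  ≡⟨ cong (_+ t) (occurrence-occupant (c ∸ t) 1≤c∸t c∸t≤2t) ⟩
      c ∸ t + t                                ≡⟨ m∸n+n≡m (<⇒≤ t<c) ⟩
      c                                        ∎
      where
      open ≡-Reasoning
      t<c = ≰⇒> c≰t
      1≤c∸t = m<n⇒0<n∸m t<c
      c∸t≤2t = m≤n+o⇒m∸n≤o c t (≤-trans c≤3t (≤-reflexive 3t≡t+t*2))

-- Skolem sequences of order 4s + 1

halve : ℕ → ℕ × Parity
halve zero          = 0 , 0ℙ
halve (suc zero)    = 0 , 1ℙ
halve (suc (suc n)) = Prod.map₁ suc (halve n)

unhalve : ℕ × Parity → ℕ
unhalve (h , 0ℙ) = h + h
unhalve (h , 1ℙ) = suc (h + h)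

halve-unhalve : ∀ x → halve (unhalve x) ≡ x
halve-unhalve (zero  , 0ℙ) = refl
halve-unhalve (zero  , 1ℙ) = refl
halve-unhalve (suc h , p)  = begin
  halve (unhalve (suc h , p))         ≡⟨ cong halve (lemma p) ⟩
  halve (suc (suc (unhalve (h , p)))) ≡⟨ cong (Prod.map₁ suc) (halve-unhalve (h , p)) ⟩
  suc h , p                           ∎
  where
  open ≡-Reasoning
  lemma : ∀ p → unhalve (suc h , p) ≡ suc (suc (unhalve (h , p)))
  lemma 0ℙ = cong suc (+-suc h h)
  lemma 1ℙ = cong (λ n → suc (suc n)) (+-suc h h)

-- For s ≥ 2, the two copies of δ ∈ {1, …, 4s + 1} sit at the positions
--   δ = 2h + 1, s ≤ h < 2s     :  2s − h,      2s + 1 + h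
--   δ = 2h + 1, 1 ≤ h ≤ s − 2  :  2s + 1 − h,  2s + 2 + h
--   δ = 2h + 2, h < 2s         :  6s + 1 − h,  6s + 3 + h
--   δ = 1, 2s − 1, 4s + 1      :  s + 1, s + 2;  2s + 2, 4s + 1;  2s + 1, 6s + 2.
-- For the symbol i : Fin t, halve (toℕ i) is (h , 0ℙ) when δ = 2h + 1 and (h , 1ℙ) when δ = 2h + 2.
module SkolemConstruction (s : ℕ) (2≤s : 2 ≤ s) where

  firstOdd : ℕ → ℕ
  firstOdd h with h ≟ 0
  ... | yes _ = suc s
  ... | no _ with h ≟ s ∸ 1
  ...   | yes _ = 2 + 2 * s
  ...   | no _ with h ≟ 2 * s
  ...     | yes _ = suc (2 * s)
  ...     | no _ with s ≤? h
  ...       | yes _ = 2 * s ∸ h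
  ...       | no _  = suc (2 * s) ∸ h

  private
    1≤s : 1 ≤ s
    1≤s = ≤-trans (s≤s z≤n) 2≤s

    s<2s : s < 2 * s
    s<2s = subst (s <_) (cong (λ x → s + x) (sym (+-identityʳ s))) (m<m+n s 1≤s)

  firstOdd-[s∸1] : firstOdd (s ∸ 1) ≡ 2 + 2 * s
  firstOdd-[s∸1] with s ∸ 1 ≟ 0
  ... | yes s∸1≡0 = ⊥-elim (<-irrefl (sym s∸1≡0) (m<n⇒0<n∸m 2≤s))
  ... | no _ with s ∸ 1 ≟ s ∸ 1
  ...   | yes _   = refl
  ...   | no s≢s = ⊥-elim (s≢s refl)

  firstOdd-2s : firstOdd (2 * s) ≡ suc (2 * s)
  firstOdd-2s with 2 * s ≟ 0
  ... | yes 2s≡0 = ⊥-elim (<-irrefl (sym 2s≡0) (<-trans 1≤s s<2s))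
  ... | no _ with 2 * s ≟ s ∸ 1
  ...   | yes 2s≡s∸1 = ⊥-elim (<-irrefl (sym 2s≡s∸1) (≤-<-trans (m∸n≤m s 1) s<2s))
  ...   | no _ with 2 * s ≟ 2 * s
  ...     | yes _    = refl
  ...     | no 2s≢2s = ⊥-elim (2s≢2s refl)

  firstOdd-high : ∀ {h} → s ≤ h → h < 2 * s → firstOdd h + h ≡ 2 * s
  firstOdd-high {h} s≤h h<2s with h ≟ 0
  ... | yes refl = ⊥-elim (<-irrefl refl (<-≤-trans 1≤s s≤h))
  ... | no _ with h ≟ s ∸ 1
  ...   | yes refl = ⊥-elim (<-irrefl refl (<-≤-trans (∸-monoʳ-< (s≤s z≤n) 1≤s) s≤h))
  ...   | no _ with h ≟ 2 * s
  ...     | yes refl = ⊥-elim (<-irrefl refl h<2s)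
  ...     | no _ with s ≤? h
  ...       | yes _   = m∸n+n≡m (<⇒≤ h<2s)
  ...       | no s≰h = ⊥-elim (s≰h s≤h)

  firstOdd-low : ∀ {h} → 1 ≤ h → 2 + h ≤ s → firstOdd h + h ≡ suc (2 * s)
  firstOdd-low {h} 1≤h 2+h≤s with h ≟ 0
  ... | yes refl = ⊥-elim (<-irrefl refl 1≤h)
  ... | no _ with h ≟ s ∸ 1
  ...   | yes refl = ⊥-elim (1+n≰n (≤-trans 2+h≤s (m≤n+m∸n s 1)))
  ...   | no _ with h ≟ 2 * s
  ...     | yes refl = ⊥-elim (1+n≰n (≤-trans (s≤s (≤-trans (<⇒≤ s<2s) (n≤1+n _))) 2+h≤s))
  ...     | no _ with s ≤? h
  ...       | yes s≤h = ⊥-elim (1+n≰n (≤-trans (n≤1+n _) (≤-trans 2+h≤s s≤h)))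
  ...       | no _    = m∸n+n≡m (≤-trans (m≤n+m h 2) (≤-trans 2+h≤s (≤-trans (<⇒≤ s<2s) (n≤1+n _))))

  t : ℕ
  t = suc (4 * s)

  firstOf : ℕ × Parity → ℕ
  firstOf (h , 0ℙ) = firstOdd h
  firstOf (h , 1ℙ) = suc (6 * s) ∸ h

  symbol : ℕ × Parity → Fin t
  symbol x = unhalve x mod t

  first : Fin t → ℕ
  first i = firstOf (halve (toℕ i))

  private
    first-symbol : ∀ x → unhalve x < t → first (symbol x) ≡ firstOf x
    first-symbol x x<t = cong firstOf (begin
      halve (toℕ (symbol x))  ≡⟨ cong halve (Finₚ.toℕ-fromℕ< _) ⟩
      halve (unhalve x % t)   ≡⟨ cong halve (m<n⇒m%n≡m x<t) ⟩
      halve (unhalve x)       ≡⟨ halve-unhalve x ⟩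
      x                       ∎)
      where open ≡-Reasoning

    toℕ-symbol : ∀ x → unhalve x < t → toℕ (symbol x) ≡ unhalve x
    toℕ-symbol x x<t = trans (Finₚ.toℕ-fromℕ< _) (m<n⇒m%n≡m x<t)

    occurrence₀ : ∀ x → unhalve x < t → occurrence first (symbol x , 0F) ≡ firstOf x
    occurrence₀ = first-symbol

    occurrence₁ : ∀ x → unhalve x < t → occurrence first (symbol x , 1F) ≡ firstOf x + suc (unhalve x)
    occurrence₁ x x<t = cong₂ (λ f i → f + suc i) (first-symbol x x<t) (toℕ-symbol x x<t)

    odd<t : ∀ {h} → h ≤ 2 * s → unhalve (h , 0ℙ) < t
    odd<t {h} h≤2s = s≤s (≤-trans (+-mono-≤ h≤2s h≤2s) (≤-reflexive (lemma s)))
      where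
      lemma : ∀ s → 2 * s + 2 * s ≡ 4 * s
      lemma = solve-∀

    even<t : ∀ {h} → h < 2 * s → unhalve (h , 1ℙ) < t
    even<t {h} h<2s = s≤s (≤-trans (+-mono-≤ h<2s (<⇒≤ h<2s)) (≤-reflexive (lemma s)))
      where
      lemma : ∀ s → 2 * s + 2 * s ≡ 4 * s
      lemma = solve-∀

    +-rearrange : ∀ k a h → a + (k + (h + h)) ≡ k + (a + h) + h
    +-rearrange = solve-∀

    low⇒≤2s : ∀ {h} → 2 + h ≤ s → h ≤ 2 * s
    low⇒≤2s 2+h≤s = ≤-trans (m≤n+m _ 2) (≤-trans 2+h≤s (<⇒≤ s<2s))

    odd-high₀ : ∀ {h} → s ≤ h → h < 2 * s → occurrence first (symbol (h , 0ℙ) , 0F) + h ≡ 2 * s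
    odd-high₀ {h} s≤h h<2s =
      trans (cong (_+ h) (occurrence₀ (h , 0ℙ) (odd<t (<⇒≤ h<2s)))) (firstOdd-high s≤h h<2s)

    odd-high₁ : ∀ {h} → s ≤ h → h < 2 * s → occurrence first (symbol (h , 0ℙ) , 1F) ≡ suc (2 * s) + h
    odd-high₁ {h} s≤h h<2s = begin
      occurrence first (symbol (h , 0ℙ) , 1F)  ≡⟨ occurrence₁ (h , 0ℙ) (odd<t (<⇒≤ h<2s)) ⟩
      firstOdd h + suc (h + h)                 ≡⟨ +-rearrange 1 (firstOdd h) h ⟩
      suc (firstOdd h + h) + h                 ≡⟨ cong (λ x → suc x + h) (firstOdd-high s≤h h<2s) ⟩
      suc (2 * s) + h                          ∎
      where open ≡-Reasoning

    odd-low₀ : ∀ {h} → 1 ≤ h → 2 + h ≤ s → occurrence first (symbol (h , 0ℙ) , 0F) + h ≡ suc (2 * s)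
    odd-low₀ {h} 1≤h 2+h≤s =
      trans (cong (_+ h) (occurrence₀ (h , 0ℙ) (odd<t (low⇒≤2s 2+h≤s)))) (firstOdd-low 1≤h 2+h≤s)

    odd-low₁ : ∀ {h} → 1 ≤ h → 2 + h ≤ s → occurrence first (symbol (h , 0ℙ) , 1F) ≡ 2 + 2 * s + h
    odd-low₁ {h} 1≤h 2+h≤s = begin
      occurrence first (symbol (h , 0ℙ) , 1F)  ≡⟨ occurrence₁ (h , 0ℙ) (odd<t (low⇒≤2s 2+h≤s)) ⟩
      firstOdd h + suc (h + h)                 ≡⟨ +-rearrange 1 (firstOdd h) h ⟩
      suc (firstOdd h + h) + h                 ≡⟨ cong (λ x → suc x + h) (firstOdd-low 1≤h 2+h≤s) ⟩
      2 + 2 * s + h                            ∎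
      where open ≡-Reasoning

    even-first+h : ∀ {h} → h < 2 * s → suc (6 * s) ∸ h + h ≡ suc (6 * s)
    even-first+h {h} h<2s = m∸n+n≡m (≤-trans (<⇒≤ h<2s) (≤-trans (m≤m+n (2 * s) (4 * s)) (≤-trans (≤-reflexive (lemma s)) (n≤1+n _))))
      where
      lemma : ∀ s → 2 * s + 4 * s ≡ 6 * s
      lemma = solve-∀

    even₀ : ∀ {h} → h < 2 * s → occurrence first (symbol (h , 1ℙ) , 0F) + h ≡ suc (6 * s)
    even₀ {h} h<2s = trans (cong (_+ h) (occurrence₀ (h , 1ℙ) (even<t h<2s))) (even-first+h h<2s)

    even₁ : ∀ {h} → h < 2 * s → occurrence first (symbol (h , 1ℙ) , 1F) ≡ 3 + 6 * s + h
    even₁ {h} h<2s = begin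
      occurrence first (symbol (h , 1ℙ) , 1F)  ≡⟨ occurrence₁ (h , 1ℙ) (even<t h<2s) ⟩
      suc (6 * s) ∸ h + (2 + (h + h))          ≡⟨ +-rearrange 2 (suc (6 * s) ∸ h) h ⟩
      2 + (suc (6 * s) ∸ h + h) + h            ≡⟨ cong (λ x → 2 + x + h) (even-first+h h<2s) ⟩
      3 + 6 * s + h                            ∎
      where open ≡-Reasoning

    position-s+1 : occurrence first (symbol (0 , 0ℙ) , 0F) ≡ suc s
    position-s+1 = occurrence₀ (0 , 0ℙ) (s≤s z≤n)

    position-s+2 : occurrence first (symbol (0 , 0ℙ) , 1F) ≡ 2 + s
    position-s+2 = trans (occurrence₁ (0 , 0ℙ) (s≤s z≤n)) (+-comm (suc s) 1)

    s∸1≤2s : s ∸ 1 ≤ 2 * s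
    s∸1≤2s = ≤-trans (m∸n≤m s 1) (<⇒≤ s<2s)

    position-2s+2 : occurrence first (symbol (s ∸ 1 , 0ℙ) , 0F) ≡ 2 + 2 * s
    position-2s+2 = trans (occurrence₀ (s ∸ 1 , 0ℙ) (odd<t s∸1≤2s)) firstOdd-[s∸1]

    position-4s+1 : occurrence first (symbol (s ∸ 1 , 0ℙ) , 1F) ≡ suc (4 * s)
    position-4s+1 = begin
      occurrence first (symbol (p , 0ℙ) , 1F)  ≡⟨ occurrence₁ (p , 0ℙ) (odd<t s∸1≤2s) ⟩
      firstOdd p + suc (p + p)                 ≡⟨ cong (_+ suc (p + p)) firstOdd-[s∸1] ⟩
      2 + 2 * s + suc (p + p)                  ≡⟨ cong (λ s′ → 2 + 2 * s′ + suc (p + p)) 1+p≡s ⟨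
      2 + 2 * suc p + suc (p + p)              ≡⟨ lemma p ⟩
      suc (4 * suc p)                          ≡⟨ cong (λ s′ → suc (4 * s′)) 1+p≡s ⟩
      suc (4 * s)                              ∎
      where
      open ≡-Reasoning
      p = s ∸ 1
      1+p≡s : suc p ≡ s
      1+p≡s = trans (+-comm 1 p) (m∸n+n≡m 1≤s)
      lemma : ∀ p → 2 + 2 * suc p + suc (p + p) ≡ suc (4 * suc p)
      lemma = solve-∀

    position-2s+1 : occurrence first (symbol (2 * s , 0ℙ) , 0F) ≡ suc (2 * s)
    position-2s+1 = trans (occurrence₀ (2 * s , 0ℙ) (odd<t ≤-refl)) firstOdd-2s

    position-6s+2 : occurrence first (symbol (2 * s , 0ℙ) , 1F) ≡ 2 + 6 * s
    position-6s+2 = trans (occurrence₁ (2 * s , 0ℙ) (odd<t ≤-refl)) (trans (cong (_+ _) firstOdd-2s) (lemma s))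
      where
      lemma : ∀ s → suc (2 * s) + suc (2 * s + 2 * s) ≡ 2 + 6 * s
      lemma = solve-∀

    reflected : ∀ {c e o} → e ≤ c → o + (c ∸ e) ≡ c → o ≡ e
    reflected {c} {e} {o} e≤c o+h≡c = +-cancelʳ-≡ (c ∸ e) o e (trans o+h≡c (sym (m+[n∸m]≡n e≤c)))

    shifted : ∀ {c e o} → c ≤ e → o ≡ c + (e ∸ c) → o ≡ e
    shifted c≤e o≡c+h = trans o≡c+h (m+[n∸m]≡n c≤e)

    s+s≡2s : s + s ≡ 2 * s
    s+s≡2s = cong (_+_ s) (sym (+-identityʳ s))

    positions-[1,s] : ∀ {e} → 1 ≤ e → e ≤ s → occurrence first (symbol (2 * s ∸ e , 0ℙ) , 0F) ≡ e
    positions-[1,s] {e} 1≤e e≤s = reflected e≤2s (odd-high₀ s≤h h<2s)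
      where
      e≤2s = ≤-trans e≤s (<⇒≤ s<2s)
      s≤h = m+n≤o⇒m≤o∸n s (≤-trans (+-monoʳ-≤ s e≤s) (≤-reflexive s+s≡2s))
      h<2s = ∸-monoʳ-< 1≤e e≤2s

    positions-[s+3,2s] : ∀ {e} → 3 + s ≤ e → e ≤ 2 * s → occurrence first (symbol (suc (2 * s) ∸ e , 0ℙ) , 0F) ≡ e
    positions-[s+3,2s] {e} 3+s≤e e≤2s = reflected (m≤n⇒m≤1+n e≤2s) (odd-low₀ (m<n⇒0<n∸m (s≤s e≤2s)) 2+h≤s)
      where
      h = suc (2 * s) ∸ e
      2+h≤s : 2 + h ≤ s
      2+h≤s = +-cancelʳ-≤ e (2 + h) s (begin
        2 + h + e        ≡⟨ cong (_+_ 2) (m∸n+n≡m (m≤n⇒m≤1+n e≤2s)) ⟩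
        2 + suc (2 * s)  ≡⟨ lemma s ⟩
        s + (3 + s)      ≤⟨ +-monoʳ-≤ s 3+s≤e ⟩
        s + e            ∎)
        where
        open ≤-Reasoning
        lemma : ∀ s → 2 + suc (2 * s) ≡ s + (3 + s)
        lemma = solve-∀

    positions-[2s+3,3s] : ∀ {e} → 3 + 2 * s ≤ e → e ≤ 3 * s → occurrence first (symbol (e ∸ (2 + 2 * s) , 0ℙ) , 1F) ≡ e
    positions-[2s+3,3s] {e} 3+2s≤e e≤3s = shifted 2+2s≤e (odd-low₁ (m<n⇒0<n∸m 3+2s≤e) 2+h≤s)
      where
      2+2s≤e = <⇒≤ 3+2s≤e
      h = e ∸ (2 + 2 * s)
      2+h≤s : 2 + h ≤ s
      2+h≤s = +-cancelˡ-≤ (2 + 2 * s) (2 + h) s (begin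
        2 + 2 * s + (2 + h)  ≡⟨ lemma (2 + 2 * s) h ⟩
        2 + (2 + 2 * s + h)  ≡⟨ cong (_+_ 2) (m+[n∸m]≡n 2+2s≤e) ⟩
        2 + e                ≤⟨ +-monoʳ-≤ 2 e≤3s ⟩
        2 + 3 * s            ≡⟨ lemma′ s ⟩
        2 + 2 * s + s        ∎)
        where
        open ≤-Reasoning
        lemma : ∀ a h → a + (2 + h) ≡ 2 + (a + h)
        lemma = solve-∀
        lemma′ : ∀ s → 2 + 3 * s ≡ 2 + 2 * s + s
        lemma′ = solve-∀

    positions-[3s+1,4s] : ∀ {e} → suc (3 * s) ≤ e → e ≤ 4 * s → occurrence first (symbol (e ∸ suc (2 * s) , 0ℙ) , 1F) ≡ e
    positions-[3s+1,4s] {e} 1+3s≤e e≤4s = shifted 1+2s≤e (odd-high₁ s≤h h<2s)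
      where
      h = e ∸ suc (2 * s)
      1+2s≤e = ≤-trans (s≤s (≤-trans (m≤n+m (2 * s) s) (≤-reflexive (lemma s)))) 1+3s≤e
        where
        lemma : ∀ s → s + 2 * s ≡ 3 * s
        lemma = solve-∀
      s≤h : s ≤ h
      s≤h = +-cancelˡ-≤ (suc (2 * s)) s h (begin
        suc (2 * s) + s      ≡⟨ lemma s ⟩
        suc (3 * s)          ≤⟨ 1+3s≤e ⟩
        e                    ≡⟨ m+[n∸m]≡n 1+2s≤e ⟨
        suc (2 * s) + h      ∎)
        where
        open ≤-Reasoning
        lemma : ∀ s → suc (2 * s) + s ≡ suc (3 * s)
        lemma = solve-∀
      h<2s : h < 2 * s
      h<2s = +-cancelˡ-≤ (suc (2 * s)) (suc h) (2 * s) (begin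
        suc (2 * s) + suc h  ≡⟨ +-suc (suc (2 * s)) h ⟩
        suc (suc (2 * s) + h) ≡⟨ cong suc (m+[n∸m]≡n 1+2s≤e) ⟩
        suc e                ≤⟨ s≤s e≤4s ⟩
        suc (4 * s)          ≡⟨ lemma s ⟩
        suc (2 * s) + 2 * s  ∎)
        where
        open ≤-Reasoning
        lemma : ∀ s → suc (4 * s) ≡ suc (2 * s) + 2 * s
        lemma = solve-∀

    positions-[4s+2,6s+1] : ∀ {e} → 2 + 4 * s ≤ e → e ≤ suc (6 * s) → occurrence first (symbol (suc (6 * s) ∸ e , 1ℙ) , 0F) ≡ e
    positions-[4s+2,6s+1] {e} 2+4s≤e e≤1+6s = reflected e≤1+6s (even₀ h<2s)
      where
      h = suc (6 * s) ∸ e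
      h<2s : h < 2 * s
      h<2s = +-cancelʳ-≤ e (suc h) (2 * s) (begin
        suc h + e            ≡⟨ cong suc (m∸n+n≡m e≤1+6s) ⟩
        suc (suc (6 * s))    ≡⟨ lemma s ⟩
        2 * s + (2 + 4 * s)  ≤⟨ +-monoʳ-≤ (2 * s) 2+4s≤e ⟩
        2 * s + e            ∎)
        where
        open ≤-Reasoning
        lemma : ∀ s → suc (suc (6 * s)) ≡ 2 * s + (2 + 4 * s)
        lemma = solve-∀

    positions-[6s+3,8s+2] : ∀ {e} → 3 + 6 * s ≤ e → e ≤ t * 2 → occurrence first (symbol (e ∸ (3 + 6 * s) , 1ℙ) , 1F) ≡ e
    positions-[6s+3,8s+2] {e} 3+6s≤e e≤2t = shifted 3+6s≤e (even₁ h<2s)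
      where
      h = e ∸ (3 + 6 * s)
      h<2s : h < 2 * s
      h<2s = +-cancelˡ-≤ (3 + 6 * s) (suc h) (2 * s) (begin
        3 + 6 * s + suc h    ≡⟨ +-suc (3 + 6 * s) h ⟩
        suc (3 + 6 * s + h)  ≡⟨ cong suc (m+[n∸m]≡n 3+6s≤e) ⟩
        suc e                ≤⟨ s≤s e≤2t ⟩
        suc (t * 2)          ≡⟨ lemma s ⟩
        3 + 6 * s + 2 * s    ∎)
        where
        open ≤-Reasoning
        lemma : ∀ s → suc (suc (4 * s) * 2) ≡ 3 + 6 * s + 2 * s
        lemma = solve-∀

  occupant : ℕ → Fin t × Fin 2
  occupant e with e ≤? s
  ... | yes _ = symbol (2 * s ∸ e , 0ℙ) , 0F
  ... | no _ with e ≟ suc s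
  ...   | yes _ = symbol (0 , 0ℙ) , 0F
  ...   | no _ with e ≟ 2 + s
  ...     | yes _ = symbol (0 , 0ℙ) , 1F
  ...     | no _ with e ≤? 2 * s
  ...       | yes _ = symbol (suc (2 * s) ∸ e , 0ℙ) , 0F
  ...       | no _ with e ≟ suc (2 * s)
  ...         | yes _ = symbol (2 * s , 0ℙ) , 0F
  ...         | no _ with e ≟ 2 + 2 * s
  ...           | yes _ = symbol (s ∸ 1 , 0ℙ) , 0F
  ...           | no _ with e ≤? 3 * s
  ...             | yes _ = symbol (e ∸ (2 + 2 * s) , 0ℙ) , 1F
  ...             | no _ with e ≤? 4 * s
  ...               | yes _ = symbol (e ∸ suc (2 * s) , 0ℙ) , 1F
  ...               | no _ with e ≟ suc (4 * s)
  ...                 | yes _ = symbol (s ∸ 1 , 0ℙ) , 1F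
  ...                 | no _ with e ≤? suc (6 * s)
  ...                   | yes _ = symbol (suc (6 * s) ∸ e , 1ℙ) , 0F
  ...                   | no _ with e ≟ 2 + 6 * s
  ...                     | yes _ = symbol (2 * s , 0ℙ) , 1F
  ...                     | no _  = symbol (e ∸ (3 + 6 * s) , 1ℙ) , 1F

  private
    above : ∀ {a e} → a < e → e ≢ suc a → suc a < e
    above a<e e≢1+a = ≤∧≢⇒< a<e (e≢1+a ∘ sym)

  occurrence-occupant : ∀ e → 1 ≤ e → e ≤ t * 2 → occurrence first (occupant e) ≡ e
  occurrence-occupant e 1≤e e≤2t with e ≤? s
  ... | yes e≤s = positions-[1,s] 1≤e e≤s
  ... | no e≰s with e ≟ suc s
  ...   | yes refl = position-s+1
  ...   | no e≢1+s with e ≟ 2 + s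
  ...     | yes refl = position-s+2
  ...     | no e≢2+s with e ≤? 2 * s
  ...       | yes e≤2s = positions-[s+3,2s] (above (above (≰⇒> e≰s) e≢1+s) e≢2+s) e≤2s
  ...       | no e≰2s with e ≟ suc (2 * s)
  ...         | yes refl = position-2s+1
  ...         | no e≢1+2s with e ≟ 2 + 2 * s
  ...           | yes refl = position-2s+2
  ...           | no e≢2+2s with e ≤? 3 * s
  ...             | yes e≤3s = positions-[2s+3,3s] (above (above (≰⇒> e≰2s) e≢1+2s) e≢2+2s) e≤3s
  ...             | no e≰3s with e ≤? 4 * s
  ...               | yes e≤4s = positions-[3s+1,4s] (≰⇒> e≰3s) e≤4s
  ...               | no e≰4s with e ≟ suc (4 * s)
  ...                 | yes refl = position-4s+1
  ...                 | no e≢1+4s with e ≤? suc (6 * s)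
  ...                   | yes e≤1+6s = positions-[4s+2,6s+1] (above (≰⇒> e≰4s) e≢1+4s) e≤1+6s
  ...                   | no e≰1+6s with e ≟ 2 + 6 * s
  ...                     | yes refl = position-6s+2
  ...                     | no e≢2+6s = positions-[6s+3,8s+2] (above (≰⇒> e≰1+6s) e≢2+6s) e≤2t

  skolemSequence : SkolemSequence t
  skolemSequence = record
    { first               = first
    ; occupant            = occupant
    ; occurrence-occupant = occurrence-occupant
    }

skolemSequence₁ : SkolemSequence 1
skolemSequence₁ = record
  { first               = λ _ → 1
  ; occupant            = λ { 1 → 0F , 0F ; _ → 0F , 1F }
  ; occurrence-occupant = λ { 1 _ _ → refl ; 2 _ _ → refl ; (suc (suc (suc _))) _ (s≤s (s≤s ())) }
  }

-- 2 4 2 3 5 4 3 1 1 5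
skolemSequence₅ : SkolemSequence 5
skolemSequence₅ = record
  { first               = first
  ; occupant            = occupant
  ; occurrence-occupant = occurrence-occupant
  }
  where
  first : Fin 5 → ℕ
  first 0F = 8
  first 1F = 1
  first 2F = 4
  first 3F = 2
  first 4F = 5

  occupant : ℕ → Fin 5 × Fin 2
  occupant 1 = 1F , 0F
  occupant 2 = 3F , 0F
  occupant 3 = 1F , 1F
  occupant 4 = 2F , 0F
  occupant 5 = 4F , 0F
  occupant 6 = 3F , 1F
  occupant 7 = 2F , 1F
  occupant 8 = 0F , 0F
  occupant 9 = 0F , 1F
  occupant _ = 4F , 1F

  occurrence-occupant : ∀ e → 1 ≤ e → e ≤ 5 * 2 → occurrence first (occupant e) ≡ e
  occurrence-occupant 1  _ _ = refl
  occurrence-occupant 2  _ _ = refl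
  occurrence-occupant 3  _ _ = refl
  occurrence-occupant 4  _ _ = refl
  occurrence-occupant 5  _ _ = refl
  occurrence-occupant 6  _ _ = refl
  occurrence-occupant 7  _ _ = refl
  occurrence-occupant 8  _ _ = refl
  occurrence-occupant 9  _ _ = refl
  occurrence-occupant 10 _ _ = refl
  occurrence-occupant (suc (suc (suc (suc (suc (suc (suc (suc (suc (suc (suc k)))))))))))  _ e≤10 =
    ⊥-elim (from-no (11 ≤? 10) (≤-trans (m≤m+n 11 k) e≤10))

skolemSequence : ∀ s → SkolemSequence (suc (4 * s))
skolemSequence 0             = skolemSequence₁
skolemSequence 1             = skolemSequence₅
skolemSequence (suc (suc u)) = SkolemConstruction.skolemSequence (2 + u) (s≤s (s≤s z≤n))

-- The difference family

module _ {A : Set} (_≟_ : DecidableEquality A) where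

  count : A → List A → ℕ
  count x xs = length (List.filter (_≟ x) xs)

  count-∉ : ∀ {x xs} → x ∉ xs → count x xs ≡ 0
  count-∉ {x} {xs} x∉xs =
    cong length (Listₚ.filter-none (_≟ x) (All.map (_∘ sym) (All.¬Any⇒All¬ xs x∉xs)))

  count-unique : ∀ {x xs} → Unique xs → x ∈ xs → count x xs ≡ 1
  count-unique {x} {_ ∷ ys} (x∉ys ∷ _) (here refl) = begin
    length (List.filter (_≟ x) (x ∷ ys))  ≡⟨ cong length (Listₚ.filter-accept (_≟ x) refl) ⟩
    suc (length (List.filter (_≟ x) ys))  ≡⟨ cong suc (count-∉ (All.All¬⇒¬Any x∉ys)) ⟩
    1                                     ∎
    where open ≡-Reasoning
  count-unique {x} {y ∷ ys} (y≢ys ∷ ys-unique) (there x∈ys) = begin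
    length (List.filter (_≟ x) (y ∷ ys))  ≡⟨ cong length (Listₚ.filter-reject (_≟ x) (All.lookup y≢ys x∈ys)) ⟩
    length (List.filter (_≟ x) ys)        ≡⟨ count-unique ys-unique x∈ys ⟩
    1                                     ∎
    where open ≡-Reasoning

module DifferenceFamilyConstruction {k t} (O : Orthomorphism k) (H : HeffterSystem t) where
  open Orthomorphism O
  open HeffterSystem H
  open Residues (suc (6 * t))

  N : ℕ
  N = 2 + 6 * t

  half : ℕ
  half = suc (3 * t)

  G : AbGroupData
  G = ZZ k N

  open AbGroupData G using (Carrier; _⊕_; ⊖_; _⊝_; 0#)

  private
    N≡half+half : N ≡ half + half
    N≡half+half = lemma t
      where
      lemma : ∀ t → 2 + 6 * t ≡ suc (3 * t) + suc (3 * t)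
      lemma = solve-∀

    ≤3t⇒<half : ∀ {a} → a ≤ 3 * t → a < half
    ≤3t⇒<half = s≤s

    ≤3t⇒half<N∸ : ∀ {a} → a ≤ 3 * t → half < N ∸ a
    ≤3t⇒half<N∸ {a} a≤3t = m+n≤o⇒m≤o∸n (suc half) (begin
      suc half + a      ≤⟨ +-monoʳ-≤ (suc half) a≤3t ⟩
      suc half + 3 * t  ≡⟨ lemma t ⟩
      N                 ∎)
      where
      open ≤-Reasoning
      lemma : ∀ t → suc (suc (3 * t)) + 3 * t ≡ 2 + 6 * t
      lemma = solve-∀

    half<N : half < N
    half<N = subst (half <_) (sym N≡half+half) (m<m+n half (s≤s z≤n))

    entry<N : ∀ x → entry x < N
    entry<N x = <-trans (≤3t⇒<half (entry-bounded x)) half<N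

  ⟦_⟧ : Fin t × Fin 3 → Fin N
  ⟦ x ⟧ = fromℕ< (entry<N x)

  baseTriple : Fin t × Z₂^ k → Triple G
  baseTriple (i , v) = 0# , (v , ⟦ i , 0F ⟧) , (φ v , ⟦ i , 2F ⟧)

  Index : Set
  Index = (Fin t × Z₂^ k) × (Fin 3 × Sign)

  -- With x = (v , a) and y = (φ v , a + b) for the Heffter triple (a , b , a + b) at i, the oriented
  -- edge (p , ±) is 0x, xy or 0y for p = 0, 1, 2, so its difference has ℤ_N-part ± the p-th entry.
  difference : Index → Carrier
  difference ((i , v) , 0F , Sign.-) = 0# ⊝ (v , ⟦ i , 0F ⟧)
  difference ((i , v) , 0F , Sign.+) = (v , ⟦ i , 0F ⟧) ⊝ 0#
  difference ((i , v) , 2F , Sign.-) = 0# ⊝ (φ v , ⟦ i , 2F ⟧)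
  difference ((i , v) , 2F , Sign.+) = (φ v , ⟦ i , 2F ⟧) ⊝ 0#
  difference ((i , v) , 1F , Sign.-) = (v , ⟦ i , 0F ⟧) ⊝ (φ v , ⟦ i , 2F ⟧)
  difference ((i , v) , 1F , Sign.+) = (φ v , ⟦ i , 2F ⟧) ⊝ (v , ⟦ i , 0F ⟧)

  orientedEdges : List (Fin 3 × Sign)
  orientedEdges = (0F , Sign.-) ∷ (0F , Sign.+) ∷ (2F , Sign.-) ∷ (2F , Sign.+) ∷ (1F , Sign.-) ∷ (1F , Sign.+) ∷ []

  Δ-baseTriple : ∀ b → Δ G (baseTriple b) ≡ List.map (difference ∘ (b ,_)) orientedEdges
  Δ-baseTriple (i , v) = refl

  edgeVector : Fin 3 → Z₂^ k → Z₂^ k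
  edgeVector 0F = id
  edgeVector 1F = λ v → v +₂ φ v
  edgeVector 2F = φ

  edgeVector⁻¹ : Fin 3 → Z₂^ k → Z₂^ k
  edgeVector⁻¹ 0F = id
  edgeVector⁻¹ 1F = ψ⁻¹
  edgeVector⁻¹ 2F = φ⁻¹

  edgeVector⁻¹∘edgeVector : ∀ p → edgeVector⁻¹ p ∘ edgeVector p ≗ id
  edgeVector⁻¹∘edgeVector 0F v = refl
  edgeVector⁻¹∘edgeVector 1F v = ψ⁻¹∘ψ v
  edgeVector⁻¹∘edgeVector 2F v = φ⁻¹∘φ v

  edgeVector∘edgeVector⁻¹ : ∀ p → edgeVector p ∘ edgeVector⁻¹ p ≗ id
  edgeVector∘edgeVector⁻¹ 0F v = refl
  edgeVector∘edgeVector⁻¹ 1F v = ψ∘ψ⁻¹ v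
  edgeVector∘edgeVector⁻¹ 2F v = φ∘φ⁻¹ v

  signed : Sign → ℕ → ℕ
  signed Sign.+ a = a
  signed Sign.- a = N ∸ a

  private
    -₂≡+₂ : ∀ (u w : Z₂^ k) → zipWith (addMod 2) u (map (negMod 2) w) ≡ u +₂ w
    -₂≡+₂ u w = cong (u +₂_) (neg₂≗id w)

  proj₁-difference : ∀ b e → proj₁ (difference (b , e)) ≡ edgeVector (proj₁ e) (proj₂ b)
  proj₁-difference (i , v) (0F , Sign.-) = trans (-₂≡+₂ 0₂ v) (+₂-identityˡ v)
  proj₁-difference (i , v) (0F , Sign.+) = trans (-₂≡+₂ v 0₂) (+₂-identityʳ v)
  proj₁-difference (i , v) (2F , Sign.-) = trans (-₂≡+₂ 0₂ (φ v)) (+₂-identityˡ (φ v))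
  proj₁-difference (i , v) (2F , Sign.+) = trans (-₂≡+₂ (φ v) 0₂) (+₂-identityʳ (φ v))
  proj₁-difference (i , v) (1F , Sign.-) = -₂≡+₂ v (φ v)
  proj₁-difference (i , v) (1F , Sign.+) = trans (-₂≡+₂ (φ v) v) (+₂-comm (φ v) v)

  private
    toℕ-⟦⟧ : ∀ x → toℕ ⟦ x ⟧ ≡ entry x
    toℕ-⟦⟧ x = Finₚ.toℕ-fromℕ< (entry<N x)

    toℕ-⟦⟧-⊝-0 : ∀ x → toℕ (⟦ x ⟧ ⊝ₙ zero) ≡ entry x
    toℕ-⟦⟧-⊝-0 x = trans (toℕ-⊝ₙ-≥ z≤n) (toℕ-⟦⟧ x)

    toℕ-0-⊝-⟦⟧ : ∀ x → toℕ (zero ⊝ₙ ⟦ x ⟧) ≡ N ∸ entry x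
    toℕ-0-⊝-⟦⟧ x = trans (toℕ-⊝ₙ-< (subst (0 <_) (sym (toℕ-⟦⟧ x)) (entry-positive x))) (cong (N ∸_) (toℕ-⟦⟧ x))

    P<R : ∀ i → entry (i , 0F) < entry (i , 2F)
    P<R i = subst (entry (i , 0F) <_) (entry-sum i) (m<m+n (entry (i , 0F)) (entry-positive (i , 1F)))

  toℕ-difference : ∀ b e → toℕ (proj₂ (difference (b , e))) ≡ signed (proj₂ e) (entry (proj₁ b , proj₁ e))
  toℕ-difference (i , v) (0F , Sign.-) = toℕ-0-⊝-⟦⟧ (i , 0F)
  toℕ-difference (i , v) (0F , Sign.+) = toℕ-⟦⟧-⊝-0 (i , 0F)
  toℕ-difference (i , v) (2F , Sign.-) = toℕ-0-⊝-⟦⟧ (i , 2F)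
  toℕ-difference (i , v) (2F , Sign.+) = toℕ-⟦⟧-⊝-0 (i , 2F)
  toℕ-difference (i , v) (1F , Sign.-) = begin
    toℕ (⟦ i , 0F ⟧ ⊝ₙ ⟦ i , 2F ⟧)  ≡⟨ toℕ-⊝ₙ-< (subst₂ _<_ (sym (toℕ-⟦⟧ (i , 0F))) (sym (toℕ-⟦⟧ (i , 2F))) (P<R i)) ⟩
    toℕ ⟦ i , 0F ⟧ + (N ∸ toℕ ⟦ i , 2F ⟧)  ≡⟨ cong₂ (λ a c → a + (N ∸ c)) (toℕ-⟦⟧ (i , 0F)) (toℕ-⟦⟧ (i , 2F)) ⟩
    P + (N ∸ R)                    ≡⟨ cong (λ c → P + (N ∸ c)) (entry-sum i) ⟨
    P + (N ∸ (P + Q))              ≡⟨ +-∸-assoc P (≤-trans (≤-reflexive (entry-sum i)) (<⇒≤ (entry<N (i , 2F)))) ⟨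
    P + N ∸ (P + Q)                ≡⟨ [m+n]∸[m+o]≡n∸o P N Q ⟩
    N ∸ Q                          ∎
    where
    open ≡-Reasoning
    P = entry (i , 0F)
    Q = entry (i , 1F)
    R = entry (i , 2F)
  toℕ-difference (i , v) (1F , Sign.+) = begin
    toℕ (⟦ i , 2F ⟧ ⊝ₙ ⟦ i , 0F ⟧)  ≡⟨ toℕ-⊝ₙ-≥ (subst₂ _≤_ (sym (toℕ-⟦⟧ (i , 0F))) (sym (toℕ-⟦⟧ (i , 2F))) (<⇒≤ (P<R i))) ⟩
    toℕ ⟦ i , 2F ⟧ ∸ toℕ ⟦ i , 0F ⟧  ≡⟨ cong₂ _∸_ (toℕ-⟦⟧ (i , 2F)) (toℕ-⟦⟧ (i , 0F)) ⟩
    R ∸ P                          ≡⟨ cong (_∸ P) (entry-sum i) ⟨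
    P + Q ∸ P                      ≡⟨ m+n∸m≡n P Q ⟩
    Q                              ∎
    where
    open ≡-Reasoning
    P = entry (i , 0F)
    Q = entry (i , 1F)
    R = entry (i , 2F)

  IsHole : Carrier → Set
  IsHole (u , z) = toℕ z ≡ 0 ⊎ toℕ z ≡ half

  decodeAt : Z₂^ k → (z : ℕ) → Dec (z < half) → Index
  decodeAt u z (yes _) = let (i , p) = index z in (i , edgeVector⁻¹ p u) , p , Sign.+
  decodeAt u z (no _)  = let (i , p) = index (N ∸ z) in (i , edgeVector⁻¹ p u) , p , Sign.-

  decode : Carrier → Index
  decode (u , z) = decodeAt u (toℕ z) (toℕ z <? half)

  private
    decode-≡ : ∀ {g u n} → proj₁ g ≡ u → toℕ (proj₂ g) ≡ n → decode g ≡ decodeAt u n (n <? half)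
    decode-≡ refl refl = refl

    decodeAt-signed : ∀ u x s (d : Dec (signed s (entry x) < half)) →
                      decodeAt u (signed s (entry x)) d ≡ ((proj₁ x , edgeVector⁻¹ (proj₂ x) u) , proj₂ x , s)
    decodeAt-signed u x Sign.+ (yes _)  = cong (λ (i , p) → (i , edgeVector⁻¹ p u) , p , Sign.+) (index-entry x)
    decodeAt-signed u x Sign.+ (no x≮h) = ⊥-elim (x≮h (≤3t⇒<half (entry-bounded x)))
    decodeAt-signed u x Sign.- (yes <h) = ⊥-elim (<-asym <h (≤3t⇒half<N∸ (entry-bounded x)))
    decodeAt-signed u x Sign.- (no _)   = cong (λ (i , p) → (i , edgeVector⁻¹ p u) , p , Sign.-) (begin
      index (N ∸ (N ∸ entry x))  ≡⟨ cong index (m∸[m∸n]≡n (<⇒≤ (entry<N x))) ⟩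
      index (entry x)            ≡⟨ index-entry x ⟩
      x                          ∎)
      where open ≡-Reasoning

  decode-difference : ∀ x → decode (difference x) ≡ x
  decode-difference ((i , v) , p , s) = begin
    decode (difference ((i , v) , p , s))
      ≡⟨ decode-≡ (proj₁-difference (i , v) (p , s)) (toℕ-difference (i , v) (p , s)) ⟩
    decodeAt (edgeVector p v) (signed s (entry (i , p))) _
      ≡⟨ decodeAt-signed (edgeVector p v) (i , p) s _ ⟩
    (i , edgeVector⁻¹ p (edgeVector p v)) , p , s
      ≡⟨ cong (λ w → (i , w) , p , s) (edgeVector⁻¹∘edgeVector p v) ⟩
    (i , v) , p , s
      ∎
    where open ≡-Reasoning

  difference-decode : ∀ g → ¬ IsHole g → difference (decode g) ≡ g
  difference-decode (u , z) z∉holes with toℕ z <? half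
  ... | yes z<half = cong₂ _,_
    (trans (proj₁-difference _ (p , Sign.+)) (edgeVector∘edgeVector⁻¹ p u))
    (Finₚ.toℕ-injective (trans (toℕ-difference _ (p , Sign.+)) (entry-index (toℕ z) 1≤z (s≤s⁻¹ z<half))))
    where
    p = proj₂ (index (toℕ z))
    1≤z = n≢0⇒n>0 (z∉holes ∘ inj₁)
  ... | no z≮half = cong₂ _,_
    (trans (proj₁-difference _ (p , Sign.-)) (edgeVector∘edgeVector⁻¹ p u))
    (Finₚ.toℕ-injective toℕ-difference-decode)
    where
    p = proj₂ (index (N ∸ toℕ z))
    1≤N∸z = m<n⇒0<n∸m (Finₚ.toℕ<n z)
    half<z = ≤∧≢⇒< (≮⇒≥ z≮half) (z∉holes ∘ inj₂ ∘ sym)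

    N∸z≤3t : N ∸ toℕ z ≤ 3 * t
    N∸z≤3t = m≤n+o⇒m∸n≤o N (toℕ z) (begin
      N                  ≡⟨ lemma t ⟩
      suc half + 3 * t   ≤⟨ +-monoˡ-≤ (3 * t) half<z ⟩
      toℕ z + 3 * t      ∎)
      where
      open ≤-Reasoning
      lemma : ∀ t → 2 + 6 * t ≡ suc (suc (3 * t)) + 3 * t
      lemma = solve-∀

    toℕ-difference-decode : toℕ (proj₂ (difference (decodeAt u (toℕ z) (no z≮half)))) ≡ toℕ z
    toℕ-difference-decode = begin
      toℕ (proj₂ (difference (decodeAt u (toℕ z) (no z≮half))))  ≡⟨ toℕ-difference _ (p , Sign.-) ⟩
      N ∸ entry (index (N ∸ toℕ z))  ≡⟨ cong (N ∸_) (entry-index (N ∸ toℕ z) 1≤N∸z N∸z≤3t) ⟩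
      N ∸ (N ∸ toℕ z)                ≡⟨ m∸[m∸n]≡n (<⇒≤ (Finₚ.toℕ<n z)) ⟩
      toℕ z                          ∎
      where open ≡-Reasoning

  difference-∉holes : ∀ x → ¬ IsHole (difference x)
  difference-∉holes ((i , v) , p , s) hole = signed-∉holes s (entry-positive (i , p)) (entry-bounded (i , p))
    (Sum.map (trans (sym (toℕ-difference (i , v) (p , s)))) (trans (sym (toℕ-difference (i , v) (p , s)))) hole)
    where
    signed-∉holes : ∀ s {a} → 1 ≤ a → a ≤ 3 * t → ¬ (signed s a ≡ 0 ⊎ signed s a ≡ half)
    signed-∉holes Sign.+ 1≤a a≤3t (inj₁ a≡0)    = <-irrefl (sym a≡0) 1≤a
    signed-∉holes Sign.+ 1≤a a≤3t (inj₂ a≡half) = <-irrefl a≡half (≤3t⇒<half a≤3t)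
    signed-∉holes Sign.- 1≤a a≤3t (inj₁ ≡0)     = <-irrefl (sym ≡0) (<-trans (s≤s z≤n) (≤3t⇒half<N∸ a≤3t))
    signed-∉holes Sign.- 1≤a a≤3t (inj₂ ≡half)  = <-irrefl (sym ≡half) (≤3t⇒half<N∸ a≤3t)

  bases : List (Fin t × Z₂^ k)
  bases = List.cartesianProduct (List.allFin t) (allZ₂^ k)

  indices : List Index
  indices = List.cartesianProduct bases orientedEdges

  baseTriples : List (Triple G)
  baseTriples = List.map baseTriple bases

  ΔT-baseTriples : ΔT G baseTriples ≡ List.map difference indices
  ΔT-baseTriples = go bases
    where
    go : ∀ bs → ΔT G (List.map baseTriple bs) ≡ List.map difference (List.cartesianProduct bs orientedEdges)
    go []       = refl
    go (b ∷ bs) = begin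
      Δ G (baseTriple b) List.++ ΔT G (List.map baseTriple bs)
        ≡⟨ cong₂ List._++_ (trans (Δ-baseTriple b) (Listₚ.map-∘ {g = difference} {f = b ,_} orientedEdges)) (go bs) ⟩
      List.map difference (List.map (b ,_) orientedEdges) List.++ List.map difference (List.cartesianProduct bs orientedEdges)
        ≡⟨ Listₚ.map-++ difference (List.map (b ,_) orientedEdges) _ ⟨
      List.map difference (List.cartesianProduct (b ∷ bs) orientedEdges)
        ∎
      where open ≡-Reasoning

  ∈-indices : ∀ x → x ∈ indices
  ∈-indices ((i , v) , e) =
    ∈-cartesianProduct⁺ (∈-cartesianProduct⁺ (∈-allFin i) (∈-allZ₂^ v)) (∈-orientedEdges e)
    where
    ∈-orientedEdges : ∀ e → e ∈ orientedEdges
    ∈-orientedEdges (0F , Sign.-) = here refl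
    ∈-orientedEdges (0F , Sign.+) = there (here refl)
    ∈-orientedEdges (2F , Sign.-) = there (there (here refl))
    ∈-orientedEdges (2F , Sign.+) = there (there (there (here refl)))
    ∈-orientedEdges (1F , Sign.-) = there (there (there (there (here refl))))
    ∈-orientedEdges (1F , Sign.+) = there (there (there (there (there (here refl)))))

  differences-unique : Unique (List.map difference indices)
  differences-unique = Unique.map⁺ difference-injective
    (Unique.cartesianProduct⁺ (Unique.cartesianProduct⁺ (Unique.allFin⁺ t) (allZ₂^-unique k)) orientedEdges-unique)
    where
    difference-injective : ∀ {x y} → difference x ≡ difference y → x ≡ y
    difference-injective {x} {y} dx≡dy = trans (sym (decode-difference x)) (trans (cong decode dx≡dy) (decode-difference y))
    orientedEdges-unique : Unique orientedEdges
    orientedEdges-unique = from-yes (AllPairs.allPairs? (λ e e′ → ¬? (Prodₚ.≡-dec Finₚ._≟_ Sign._≟_ e e′)) orientedEdges)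

  multiplicity-∉holes : ∀ g → ¬ IsHole g → multiplicity G g (ΔT G baseTriples) ≡ 1
  multiplicity-∉holes g g∉holes = begin
    multiplicity G g (ΔT G baseTriples)             ≡⟨ cong (multiplicity G g) ΔT-baseTriples ⟩
    multiplicity G g (List.map difference indices)  ≡⟨ count-unique (AbGroupData._≟_ G) differences-unique g∈ ⟩
    1                                               ∎
    where
    open ≡-Reasoning
    g∈ : g ∈ List.map difference indices
    g∈ = subst (_∈ _) (difference-decode g g∉holes) (∈-map⁺ difference (∈-indices (decode g)))

  multiplicity-holes : ∀ g → IsHole g → multiplicity G g (ΔT G baseTriples) ≡ 0
  multiplicity-holes g hole = trans (cong (multiplicity G g) ΔT-baseTriples) (count-∉ (AbGroupData._≟_ G) g∉)
    where
    g∉ : g ∉ List.map difference indices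
    g∉ g∈ with Any.satisfied (Any.map⁻ g∈)
    ... | x , refl = difference-∉holes x hole

  open OrderTwoSubgroups G using (Involution; elem)
  open OrderTwoSubgroups.Spread G ZZ-identityˡ ZZ-identityʳ ZZ-⊖0#

  ⟦half⟧ : Fin N
  ⟦half⟧ = fromℕ< half<N

  level : Fin 2 → Fin N
  level 0F = zero
  level 1F = ⟦half⟧

  hole : Z₂^ (suc k) → Carrier
  hole (b ∷ v) = v , level b

  private
    toℕ-⟦half⟧ : toℕ ⟦half⟧ ≡ half
    toℕ-⟦half⟧ = Finₚ.toℕ-fromℕ< half<N

    ⟦half⟧+⟦half⟧≡N : toℕ ⟦half⟧ + toℕ ⟦half⟧ ≡ N
    ⟦half⟧+⟦half⟧≡N = trans (cong₂ _+_ toℕ-⟦half⟧ toℕ-⟦half⟧) (sym N≡half+half)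

    level-injective : ∀ {b c} → level b ≡ level c → b ≡ c
    level-injective {0F} {0F} _   = refl
    level-injective {0F} {1F} 0≡h = ⊥-elim (1+n≢0 (trans (sym toℕ-⟦half⟧) (cong toℕ (sym 0≡h))))
    level-injective {1F} {0F} h≡0 = ⊥-elim (1+n≢0 (trans (sym toℕ-⟦half⟧) (cong toℕ h≡0)))
    level-injective {1F} {1F} _   = refl

    level-doubled : ∀ b → addMod N (level b) (level b) ≡ zero
    level-doubled 0F = addMod-identityˡ zero
    level-doubled 1F = addMod-self ⟦half⟧ ⟦half⟧+⟦half⟧≡N

    level-negated : ∀ b → negMod N (level b) ≡ level b
    level-negated 0F = negMod-zero
    level-negated 1F = negMod-self ⟦half⟧ ⟦half⟧+⟦half⟧≡N

  hole-injective : ∀ {w w′} → hole w ≡ hole w′ → w ≡ w′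
  hole-injective {b ∷ v} {c ∷ v′} eq = cong₂ _∷_ (level-injective (cong proj₂ eq)) (cong proj₁ eq)

  hole⊕hole : ∀ w → hole w ⊕ hole w ≡ 0#
  hole⊕hole (b ∷ v) = cong₂ _,_ (+₂-self v) (level-doubled b)

  ⊖hole : ∀ w → ⊖ hole w ≡ hole w
  ⊖hole (b ∷ v) = cong₂ _,_ (neg₂≗id v) (level-negated b)

  holeInvolution : ∃ (λ (w : Z₂^ (suc k)) → w ≢ 0₂) → Involution
  holeInvolution (w , w≢0) = record
    { elem      = hole w
    ; elem≢0#   = w≢0 ∘ hole-injective {w} {0₂}
    ; elem⊕elem = hole⊕hole w
    ; ⊖elem     = ⊖hole w
    }

  holes : List Involution
  holes = List.map holeInvolution (nonzeroZ₂^ (suc k))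

  hole-isHole : ∀ w → IsHole (hole w)
  hole-isHole (0F ∷ v) = inj₁ refl
  hole-isHole (1F ∷ v) = inj₂ toℕ-⟦half⟧

  isHole⇒hole : ∀ {g} → IsHole g → ∃ λ w → hole w ≡ g
  isHole⇒hole {u , z} (inj₁ z≡0)    = 0F ∷ u , cong (u ,_) (Finₚ.toℕ-injective (sym z≡0))
  isHole⇒hole {u , z} (inj₂ z≡half) = 1F ∷ u , cong (u ,_) (Finₚ.toℕ-injective (trans toℕ-⟦half⟧ (sym z≡half)))

  InUnion⇒isHole : ∀ {g} → InUnion G (spread holes) g → IsHole g
  InUnion⇒isHole g∈ with Any.satisfied (Any.map⁻ (InUnion-spread⁻ g∈))
  ... | _       , inj₁ refl = inj₁ refl
  ... | (w , _) , inj₂ refl = hole-isHole w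

  isHole⇒InUnion : ∀ {g} → IsHole g → InUnion G (spread holes) g
  isHole⇒InUnion {g} g-hole with isHole⇒hole g-hole
  ... | w , hw≡g with w ≟₂ 0₂
  ...   | yes w≡0 = InUnion-spread⁺ (Any.map⁺ (Any.map (λ _ → inj₁ g≡0#) (Any.map⁻ (∈-nonzeroZ₂^ (1F ∷ 0₂) λ ()))))
    where
    g≡0# : g ≡ 0#
    g≡0# = trans (sym hw≡g) (cong hole w≡0)
  ...   | no w≢0  = InUnion-spread⁺ (Any.map⁺ (Any.map (λ w≡ → inj₂ (trans (sym hw≡g) (cong hole w≡))) (Any.map⁻ (∈-nonzeroZ₂^ w w≢0))))

  holes-unique : Unique (List.map elem holes)
  holes-unique = subst Unique elem-holes (Unique.map⁺ hole-injective (nonzeroZ₂^-unique (suc k)))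
    where
    elem-holes : List.map hole (List.map proj₁ (nonzeroZ₂^ (suc k))) ≡ List.map elem holes
    elem-holes = trans (sym (Listₚ.map-∘ (nonzeroZ₂^ (suc k)))) (Listₚ.map-∘ (nonzeroZ₂^ (suc k)))

  length-holes : length holes ≡ 2 ^ suc k ∸ 1
  length-holes = trans (Listₚ.length-map holeInvolution (nonzeroZ₂^ (suc k))) (length-nonzeroZ₂^ (suc k))

  baseTriple-distinct : ∀ b → Distinct G (baseTriple b)
  baseTriple-distinct (i , v) = 0≢x , 0≢y , x≢y
    where
    toℕ-proj₂ : ∀ {g g′ : Carrier} → g ≡ g′ → toℕ (proj₂ g) ≡ toℕ (proj₂ g′)
    toℕ-proj₂ = cong (toℕ ∘ proj₂)
    0≢x = λ eq → <-irrefl (trans (toℕ-proj₂ eq) (toℕ-⟦⟧ (i , 0F))) (entry-positive (i , 0F))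
    0≢y = λ eq → <-irrefl (trans (toℕ-proj₂ eq) (toℕ-⟦⟧ (i , 2F))) (entry-positive (i , 2F))
    x≢y = λ eq → <-irrefl (trans (sym (toℕ-⟦⟧ (i , 0F))) (trans (toℕ-proj₂ eq) (toℕ-⟦⟧ (i , 2F)))) (P<R i)

  differenceFamily : HasDifferenceFamily₁ G 2 (2 ^ suc k ∸ 1)
  differenceFamily =
    spread holes , spread-isPartialSpread holes-unique , Prod.map₁ (λ eq → trans eq length-holes) (spread-hasType holes) ,
    baseTriples , All.map⁺ (All.universal baseTriple-distinct bases) ,
    λ g → multiplicity-holes g ∘ InUnion⇒isHole , λ g∉ → multiplicity-∉holes g (g∉ ∘ isHole⇒InUnion)

-- The modulus

-1^[2+n] : ∀ n → -1ℤ ℤB.^ (2 + n) ≡ -1ℤ ℤB.^ n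
-1^[2+n] n = trans (sym (ℤP.*-assoc -1ℤ -1ℤ (-1ℤ ℤB.^ n))) (ℤP.*-identityˡ (-1ℤ ℤB.^ n))

-- ℤD._∣_ divides absolute values, and ∣ + suc d - 1ℤ ∣ computes to d, ∣ + d - -1ℤ ∣ to d + 1.
2^j*d≡1[mod3] : ∀ j d → (+ 6) ℤD.∣ (+ d - -1ℤ ℤB.^ j) → ∃ λ s → 2 ^ j * d ≡ 1 + 3 * s
2^j*d≡1[mod3] 0 zero (divides zero ())
2^j*d≡1[mod3] 0 zero (divides (suc q) ())
2^j*d≡1[mod3] 0 (suc d) (divides q d≡q*6) = 2 * q , trans (cong (λ x → 1 * suc x) d≡q*6) (lemma q)
  where
  lemma : ∀ q → 1 * suc (q * 6) ≡ 1 + 3 * (2 * q)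
  lemma = solve-∀
2^j*d≡1[mod3] 1 d (divides zero d+1≡0) = ⊥-elim (1+n≢0 (trans (+-comm 1 d) d+1≡0))
2^j*d≡1[mod3] 1 d (divides (suc q) d+1≡6+q*6) = 3 + 4 * q , trans (cong (λ x → 2 * 1 * x) d≡5+q*6) (lemma q)
  where
  d≡5+q*6 : d ≡ 5 + q * 6
  d≡5+q*6 = +-cancelʳ-≡ 1 d (5 + q * 6) (trans d+1≡6+q*6 (+-comm 1 (5 + q * 6)))
  lemma : ∀ q → 2 * 1 * (5 + q * 6) ≡ 1 + 3 * (3 + 4 * q)
  lemma = solve-∀
2^j*d≡1[mod3] (suc (suc j)) d 6∣d-[-1]^j with 2^j*d≡1[mod3] j d (subst (λ x → (+ 6) ℤD.∣ (+ d - x)) (-1^[2+n] j) 6∣d-[-1]^j)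
... | s , 2^j*d≡1+3s = 1 + 4 * s , (begin
  2 * (2 * 2 ^ j) * d  ≡⟨ lemma (2 ^ j) d ⟩
  4 * (2 ^ j * d)      ≡⟨ cong (4 *_) 2^j*d≡1+3s ⟩
  4 * (1 + 3 * s)      ≡⟨ lemma′ s ⟩
  1 + 3 * (1 + 4 * s)  ∎)
  where
  open ≡-Reasoning
  lemma : ∀ x d → 2 * (2 * x) * d ≡ 4 * (x * d)
  lemma = solve-∀
  lemma′ : ∀ s → 4 * (1 + 3 * s) ≡ 1 + 3 * (1 + 4 * s)
  lemma′ = solve-∀

2^[1+ℓ]*d≡2+6[1+4s] : ∀ ℓ d → 2 ≤ ℓ → (+ 6) ℤD.∣ (+ d - -1ℤ ℤB.^ ℓ) →
                      ∃ λ s → 2 ^ suc ℓ * d ≡ 2 + 6 * suc (4 * s)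
2^[1+ℓ]*d≡2+6[1+4s] (suc (suc j)) d (s≤s (s≤s _)) 6∣d-[-1]^ℓ
  with 2^j*d≡1[mod3] j d (subst (λ x → (+ 6) ℤD.∣ (+ d - x)) (-1^[2+n] j) 6∣d-[-1]^ℓ)
... | s , 2^j*d≡1+3s = s , (begin
  2 * (2 * (2 * 2 ^ j)) * d  ≡⟨ lemma (2 ^ j) d ⟩
  8 * (2 ^ j * d)            ≡⟨ cong (8 *_) 2^j*d≡1+3s ⟩
  8 * (1 + 3 * s)            ≡⟨ lemma′ s ⟩
  2 + 6 * suc (4 * s)        ∎)
  where
  open ≡-Reasoning
  lemma : ∀ x d → 2 * (2 * (2 * x)) * d ≡ 8 * (x * d)
  lemma = solve-∀
  lemma′ : ∀ s → 8 * (1 + 3 * s) ≡ 2 + 6 * suc (4 * s)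
  lemma′ = solve-∀

HasDifferenceFamily₁-cong : ∀ {k n n′ o f} .{{_ : NonZero n}} .{{_ : NonZero n′}} →
                            n ≡ n′ → HasDifferenceFamily₁ (ZZ k n) o f → HasDifferenceFamily₁ (ZZ k n′) o f
HasDifferenceFamily₁-cong refl family = family

proposition3p3 : (ℓ m d : ℕ) → 2 ≤ ℓ → 3 ≤ m → (odd : ¬ (2 ∣ d))
    → (+ 6) ℤD.∣ ((+ d) - (-1ℤ ℤB.^ ℓ))
    → HasDifferenceFamily₁ (ZZ (m ∸ 1) (2 ^ suc ℓ * d) {{odd⇒nz ℓ d odd}}) 2 (2 ^ m ∸ 1)
proposition3p3 ℓ (suc (suc (suc k))) d 2≤ℓ (s≤s (s≤s (s≤s _))) odd 6∣d-[-1]^ℓ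
  with 2^[1+ℓ]*d≡2+6[1+4s] ℓ d 2≤ℓ 6∣d-[-1]^ℓ
... | s , 2^[1+ℓ]*d≡2+6t = HasDifferenceFamily₁-cong {{_}} {{odd⇒nz ℓ d odd}} (sym 2^[1+ℓ]*d≡2+6t)
  (DifferenceFamilyConstruction.differenceFamily (orthomorphism k) (heffterSystem (skolemSequence s)))
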